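{- Let $\mathcal P\mathit{Sym}$ be the graded vector space with basis $\{F_p\}$ indexed by painted binary trees $p$, with coproduct $\Delta(F_p)=\sum_{p\to(p_0,p_1)}F_{p_0}\otimes F_{p_1}$ (sum over splittings of $p$ at one leaf, painting preserved), counit $\varepsilon(F_p)=\delta_{0,|p|}$, and product $F_p\cdot F_q=\sum_{p\to(p_0,\dots,p_r)}F_{(p_0,\dots,p_r)/q^+}$, where $r$ is the number of nodes of $q$, the sum is over splittings of $p$ at multisets of $r$ leaves (painting preserved), and $q^+$ is $q$ with all its nodes painted. Then there are unit and antipode maps $\mu\colon\mathbb K\to\mathcal P\mathit{Sym}$ and $S\colon\mathcal P\mathit{Sym}\to\mathcal P\mathit{Sym}$ making $\mathcal P\mathit{Sym}$ a one-sided Hopf algebra.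
   Context: Work over a field $\mathbb K$ of characteristic zero. A planar binary tree with $n$ internal nodes has $n+1$ leaves, numbered left to right; $|p|$ denotes the number of internal nodes. Splitting a tree along the path from a chosen leaf to the root cuts it into a left tree and a right tree, whose node counts add up to that of the original; splitting at a multiset of $r$ leaves (repeatedly) produces an ordered forest $(p_0,\dots,p_r)$ of $r+1$ trees. Grafting a forest $(p_0,\dots,p_r)$ onto a tree $q$ with $r$ internal nodes, written $(p_0,\dots,p_r)/q$, attaches the root of $p_i$ to the $i$-th leaf of $q$. A painted binary tree is a planar binary tree together with a (possibly empty) set of painted nodes closed under passing toward the root (equivalently, a planar binary tree $d$ (the painted part) with a forest of $|d|+1$ unpainted planar binary trees grafted on its leaves; thus $\mathcal P\mathit{Sym}$ is identified with $\mathcal Y\mathit{Sym}\circ\mathcal Y\mathit{Sym}$, where $\mathcal Y\mathit{Sym}$ is the Loday–Ronco Hopf algebra of planar binary trees). Under splitting and grafting, every node keeps its painted/unpainted status. There is a single painted tree with $0$ nodes. A one-sided Hopf algebra is an associative algebra with a one-sided unit, a coassociative coproduct and counit that are algebra maps, and a one-sided antipode. -}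

module Defs where

open import Level using (Level; _⊔_)
open import Data.Bool using (Bool; true; false; if_then_else_)
open import Data.Nat renaming (_+_ to _+ℕ_) using ()
open import Data.Nat using (ℕ; zero; suc; _∸_; _≤ᵇ_; _≡ᵇ_)
open import Data.List using (List; []; _∷_; [_]; map; concatMap; upTo; take; drop; foldr)
open import Data.Product using (Σ; _×_; _,_; proj₁; proj₂; ∃)
open import Data.Product.Properties using (≡-dec)
open import Data.Sum using (_⊎_)
open import Relation.Nullary using (¬_; yes; no; does)
open import Relation.Binary.Definitions using (DecidableEquality)
open import Relation.Binary.PropositionalEquality using (_≡_; refl; cong₂; cong)
open import Algebra.Bundles using (CommutativeRing)

data Tree : Set where
  lf : Tree
  nd : Tree → Tree → Tree

size : Tree → ℕ
size lf = 0
size (nd l r) = suc (size l +ℕ size r)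

-- Painted binary trees: the painted part is a planar binary tree d
-- (built with pn) carrying a forest of |d|+1 unpainted trees (un t) on
-- its leaves.  The painted nodes are thus closed toward the root.
-- The unique painted tree with 0 nodes is  un lf.

data PTree : Set where
  un : Tree → PTree
  pn : PTree → PTree → PTree

psize : PTree → ℕ
psize (un t) = size t
psize (pn l r) = suc (psize l +ℕ psize r)

forget : PTree → Tree
forget (un t) = t
forget (pn l r) = nd (forget l) (forget r)

-- Splitting at leaf i (leaves numbered 0..|t| from left to right),
-- along the path from leaf i to the root.  Nodes on the path go to the
-- right piece.  Painting is preserved.

splitT : ℕ → Tree → Tree × Tree
splitT i lf = lf , lf
splitT i (nd l r) =
  if i ≤ᵇ size l
  then (proj₁ (splitT i l) , nd (proj₂ (splitT i l)) r)
  else (nd l (proj₁ (splitT (i ∸ suc (size l)) r)) , proj₂ (splitT (i ∸ suc (size l)) r))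

psplit : ℕ → PTree → PTree × PTree
psplit i (un t) = un (proj₁ (splitT i t)) , un (proj₂ (splitT i t))
psplit i (pn l r) =
  if i ≤ᵇ psize l
  then (proj₁ (psplit i l) , pn (proj₂ (psplit i l)) r)
  else (pn l (proj₁ (psplit (i ∸ suc (psize l)) r)) , proj₂ (psplit (i ∸ suc (psize l)) r))

-- All splittings of p at multisets of r leaves, as forests (p₀,…,p_r).
-- A multiset i₁ ≤ … ≤ i_r is enumerated by choosing i₁ and then
-- splitting the right piece (whose leaves are i₁,…,n, renumbered from 0).
msplit : ℕ → PTree → List (List PTree)
msplit zero p = [ p ∷ [] ]
msplit (suc r) p =
  concatMap (λ i → map (proj₁ (psplit i p) ∷_) (msplit r (proj₂ (psplit i p))))
            (upTo (suc (psize p)))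

headOr : List PTree → PTree
headOr [] = un lf
headOr (x ∷ _) = x

-- (p₀,…,p_r) / q⁺ : graft the forest onto the leaves of q with all
-- nodes of q painted.
graft : List PTree → Tree → PTree
graft fs lf = headOr fs
graft fs (nd l r) =
  pn (graft (take (suc (size l)) fs) l) (graft (drop (suc (size l)) fs) r)

prodTrees : PTree → PTree → List PTree
prodTrees p q = map (λ f → graft f (forget q)) (msplit (psize q) p)

nd-inj : ∀ {a b c d} → nd a b ≡ nd c d → (a ≡ c) × (b ≡ d)
nd-inj refl = refl , refl

_≟T_ : DecidableEquality Tree
lf ≟T lf = yes refl
lf ≟T nd _ _ = no (λ ())
nd _ _ ≟T lf = no (λ ())
nd a b ≟T nd c d with a ≟T c | b ≟T d
... | yes refl | yes refl = yes refl
... | no ne | _ = no (λ e → ne (proj₁ (nd-inj e)))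
... | yes _ | no ne = no (λ e → ne (proj₂ (nd-inj e)))

un-inj : ∀ {a b} → un a ≡ un b → a ≡ b
un-inj refl = refl

pn-inj : ∀ {a b c d} → pn a b ≡ pn c d → (a ≡ c) × (b ≡ d)
pn-inj refl = refl , refl

_≟P_ : DecidableEquality PTree
un a ≟P un b with a ≟T b
... | yes refl = yes refl
... | no ne = no (λ e → ne (un-inj e))
un _ ≟P pn _ _ = no (λ ())
pn _ _ ≟P un _ = no (λ ())
pn a b ≟P pn c d with a ≟P c | b ≟P d
... | yes refl | yes refl = yes refl
... | no ne | _ = no (λ e → ne (proj₁ (pn-inj e)))
... | yes _ | no ne = no (λ e → ne (proj₂ (pn-inj e)))

_≟P2_ : DecidableEquality (PTree × PTree)
_≟P2_ = ≡-dec _≟P_ _≟P_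

_≟P3_ : DecidableEquality (PTree × PTree × PTree)
_≟P3_ = ≡-dec _≟P_ _≟P2_

module Over {c ℓ : Level} (K : CommutativeRing c ℓ) where
  open CommutativeRing K renaming (Carrier to 𝕂)

  natK : ℕ → 𝕂
  natK zero = 0#
  natK (suc n) = 1# + natK n

  record IsFieldChar0 : Set (c ⊔ ℓ) where
    field
      nontrivial : ¬ (0# ≈ 1#)
      inverses   : ∀ x → ¬ (x ≈ 0#) → ∃ λ y → x * y ≈ 1#
      char0      : ∀ n → ¬ (natK (suc n) ≈ 0#)

  -- Finite K-linear combinations of basis elements from B
  -- (the free K-module on B); equality is equality of all coefficients.
  Comb : Set → Set c
  Comb B = List (𝕂 × B)

  coeffOf : {B : Set} → DecidableEquality B → B → Comb B → 𝕂
  coeffOf _≟_ b [] = 0#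
  coeffOf _≟_ b ((a , b') ∷ v) = (if does (b' ≟ b) then a else 0#) + coeffOf _≟_ b v

  EqComb : {B : Set} → DecidableEquality B → Comb B → Comb B → Set ℓ
  EqComb dec v w = ∀ b → coeffOf dec b v ≈ coeffOf dec b w

  basis : {B : Set} → B → Comb B
  basis b = (1# , b) ∷ []

  scale : {B : Set} → 𝕂 → Comb B → Comb B
  scale k = map (λ ab → (k * proj₁ ab , proj₂ ab))

  ext : {B C : Set} → (B → Comb C) → Comb B → Comb C
  ext f = concatMap (λ ab → scale (proj₁ ab) (f (proj₂ ab)))

  extK : {B : Set} → (B → 𝕂) → Comb B → 𝕂
  extK f = foldr (λ ab s → proj₁ ab * f (proj₂ ab) + s) 0#

  tensor : {B C : Set} → Comb B → Comb C → Comb (B × C)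
  tensor v w = concatMap (λ ab → map (λ cd → (proj₁ ab * proj₁ cd , (proj₂ ab , proj₂ cd))) w) v

  PSym : Set c
  PSym = Comb PTree

  PSym2 : Set c
  PSym2 = Comb (PTree × PTree)

  PSym3 : Set c
  PSym3 = Comb (PTree × PTree × PTree)

  _≈V_ : PSym → PSym → Set ℓ
  _≈V_ = EqComb _≟P_

  _≈V2_ : PSym2 → PSym2 → Set ℓ
  _≈V2_ = EqComb _≟P2_

  _≈V3_ : PSym3 → PSym3 → Set ℓ
  _≈V3_ = EqComb _≟P3_

  mulB : PTree → PTree → PSym
  mulB p q = map (λ t → (1# , t)) (prodTrees p q)

  _·_ : PSym → PSym → PSym
  x · y = ext (λ p → ext (λ q → mulB p q) y) x

  _·₂_ : PSym2 → PSym2 → PSym2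
  X ·₂ Y = ext (λ pp → ext (λ qq → tensor (mulB (proj₁ pp) (proj₁ qq))
                                          (mulB (proj₂ pp) (proj₂ qq))) Y) X

  ΔB : PTree → PSym2
  ΔB p = map (λ i → (1# , psplit i p)) (upTo (suc (psize p)))

  Δ : PSym → PSym2
  Δ = ext ΔB

  εB : PTree → 𝕂
  εB p = if psize p ≡ᵇ 0 then 1# else 0#

  ε : PSym → 𝕂
  ε = extK εB

  Δ⊗id∘Δ : PSym → PSym3
  Δ⊗id∘Δ x = ext (λ pq → map (λ kab → (proj₁ kab , (proj₁ (proj₂ kab) , proj₂ (proj₂ kab) , proj₂ pq)))
                              (ΔB (proj₁ pq))) (Δ x)

  id⊗Δ∘Δ : PSym → PSym3
  id⊗Δ∘Δ x = ext (λ pq → map (λ kab → (proj₁ kab , (proj₁ pq , proj₁ (proj₂ kab) , proj₂ (proj₂ kab))))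
                              (ΔB (proj₂ pq))) (Δ x)

  ε⊗id∘Δ : PSym → PSym
  ε⊗id∘Δ x = ext (λ pq → scale (εB (proj₁ pq)) (basis (proj₂ pq))) (Δ x)

  id⊗ε∘Δ : PSym → PSym
  id⊗ε∘Δ x = ext (λ pq → scale (εB (proj₂ pq)) (basis (proj₁ pq))) (Δ x)

  -- One-sided Hopf algebra structure on PSym with unit map μ
  -- (determined by u = μ(1)) and antipode S (determined by its values
  -- s p = S(F_p) on the basis).

  S-ext : (PTree → PSym) → PSym → PSym
  S-ext s = ext s

  LeftUnit RightUnit : PSym → Set (c ⊔ ℓ)
  LeftUnit u = ∀ x → (u · x) ≈V x
  RightUnit u = ∀ x → (x · u) ≈V x

  LeftAntipode : PSym → (PTree → PSym) → Set (c ⊔ ℓ)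
  LeftAntipode u s = ∀ x → ext (λ pq → s (proj₁ pq) · basis (proj₂ pq)) (Δ x) ≈V scale (ε x) u

  RightAntipode : PSym → (PTree → PSym) → Set (c ⊔ ℓ)
  RightAntipode u s = ∀ x → ext (λ pq → basis (proj₁ pq) · s (proj₂ pq)) (Δ x) ≈V scale (ε x) u

  record IsOneSidedHopf (u : PSym) (s : PTree → PSym) : Set (c ⊔ ℓ) where
    field
      assoc      : ∀ x y z → ((x · y) · z) ≈V (x · (y · z))
      oneSidedUnit : LeftUnit u ⊎ RightUnit u
      coassoc    : ∀ x → Δ⊗id∘Δ x ≈V3 id⊗Δ∘Δ x
      counitˡ    : ∀ x → ε⊗id∘Δ x ≈V x
      counitʳ    : ∀ x → id⊗ε∘Δ x ≈V x
      Δ-mult     : ∀ x y → Δ (x · y) ≈V2 (Δ x ·₂ Δ y)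
      Δ-unit     : Δ u ≈V2 tensor u u
      ε-mult     : ∀ x y → ε (x · y) ≈ ε x * ε y
      ε-unit     : ε u ≈ 1#
      oneSidedAntipode : LeftAntipode u s ⊎ RightAntipode u s

module Submission where

-- PSym, with unit F_(un lf) and a recursively defined antipode, is a one-sided Hopf
-- algebra: F_(un lf) is a right unit (grafting p onto the one-leaf tree gives p) and
-- the antipode is a left antipode.
--
-- Every structure map is the linear extension of a map on basis trees, and two
-- combinations are equal once every linear functional agrees on them.  Each axiom
-- therefore becomes an identity of sums over lists of basis trees, which follows
-- from an identity of the lists themselves up to permutation.

open import Defs
open import Level using (Level)
open import Data.Product using (∃₂; _,_)
open import Algebra.Bundles using (CommutativeRing)

module Combinatorics where

  open import Data.Bool using (false; if_then_else_)
  open import Data.Bool.Properties using (T-≡)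
  open import Function.Bundles using (module Equivalence)
  open import Data.Nat using (ℕ; zero; suc; _+_; _∸_; _≤_; _<_; z≤n; s≤s; s≤s⁻¹; z<s; s<s; _≤ᵇ_; _<ᵇ_)
  open import Data.Nat.Properties using (≤⇒≤ᵇ; +-suc; m+n∸m≡n; +-cancelˡ-≤)
  open import Data.List using (List; []; _∷_; [_]; map; concatMap; _++_; upTo; applyUpTo)
  open import Data.List.Properties using (++-identityʳ; map-∘; map-id; map-++; map-cong; map-upTo; map-applyUpTo)
  open import Data.Product using (∃; _×_; proj₁; proj₂)
  open import Data.Sum using (_⊎_; inj₁; inj₂)
  open import Relation.Binary.PropositionalEquality using (_≡_; refl; cong; cong₂; sym; trans; subst; module ≡-Reasoning)

  -- The list monad (xs >>= f = concatMap f xs) as a calculus of finite multisets: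
  -- equalities of lists, and permutations to rearrange them.
  module ListFacts where

    open import Data.List using (concat)
    open import Data.List.Properties using (concatMap-pure; concatMap-map; concatMap-cong; map-concatMap)
    open import Data.List.Effectful using (module MonadProperties)
    open import Data.List.Relation.Binary.Permutation.Propositional as Perm
      using (_↭_; ↭-refl; ↭-sym; ↭-trans; ↭-reflexive; module PermutationReasoning)
    open import Data.List.Relation.Binary.Permutation.Propositional.Properties
      using (++⁺; ++⁺ˡ; shifts) renaming (++-assoc to ↭-++-assoc; map⁺ to ↭-map⁺)

    private variable
      a b c : Level
      A : Set a
      B : Set b
      C : Set c

    infixl 1 _>>=_
    _>>=_ : List A → (A → List B) → List B
    xs >>= f = concatMap f xs

    -- associativity of the list monad (the library states it within one universe)
    bind-assoc : {A B C : Set a} (xs : List A) (f : A → List B) (g : B → List C) →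
      ((xs >>= f) >>= g) ≡ (xs >>= λ x → f x >>= g)
    bind-assoc xs f g = sym (MonadProperties.associative xs f g)

    map-as-bind : (xs : List A) (f : A → B) → map f xs ≡ (xs >>= λ x → [ f x ])
    map-as-bind xs f = trans (sym (concatMap-pure (map f xs))) (concatMap-map [_] f xs)

    bind-congˡ : {xs ys : List A} (f : A → List B) → xs ↭ ys → (xs >>= f) ↭ (ys >>= f)
    bind-congˡ f Perm.refl = ↭-refl
    bind-congˡ f (Perm.prep x p) = ++⁺ˡ (f x) (bind-congˡ f p)
    bind-congˡ f (Perm.swap x y p) = ↭-trans (shifts (f x) (f y)) (++⁺ˡ (f y) (++⁺ˡ (f x) (bind-congˡ f p)))
    bind-congˡ f (Perm.trans p q) = ↭-trans (bind-congˡ f p) (bind-congˡ f q)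

    bind-congʳ : (xs : List A) {f g : A → List B} → (∀ x → f x ↭ g x) → (xs >>= f) ↭ (xs >>= g)
    bind-congʳ [] e = ↭-refl
    bind-congʳ (x ∷ xs) e = ++⁺ (e x) (bind-congʳ xs e)

    bind-cong : {xs ys : List A} {f g : A → List B} → xs ↭ ys → (∀ x → f x ↭ g x) → (xs >>= f) ↭ (ys >>= g)
    bind-cong {ys = ys} {f} p e = ↭-trans (bind-congˡ f p) (bind-congʳ ys e)

    bind-distrib : (xs : List A) (f g : A → List B) → (xs >>= λ x → f x ++ g x) ↭ (xs >>= f) ++ (xs >>= g)
    bind-distrib [] f g = ↭-refl
    bind-distrib (x ∷ xs) f g =
      ↭-trans (↭-++-assoc (f x) (g x) _)
        (↭-trans (++⁺ˡ (f x) (↭-trans (++⁺ˡ (g x) (bind-distrib xs f g)) (shifts (g x) (xs >>= f))))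
          (↭-sym (↭-++-assoc (f x) (xs >>= f) _)))

    bind-comm : (xs : List A) (ys : List B) (f : A → B → List C) →
      (xs >>= λ x → ys >>= λ y → f x y) ↭ (ys >>= λ y → xs >>= λ x → f x y)
    bind-comm [] ys f = ↭-reflexive (sym (bind-empty ys))
      where
        bind-empty : (ys : List B) → (ys >>= λ _ → []) ≡ [] {A = C}
        bind-empty [] = refl
        bind-empty (_ ∷ ys) = bind-empty ys
    bind-comm (x ∷ xs) ys f =
      ↭-trans (++⁺ˡ (ys >>= f x) (bind-comm xs ys f))
              (↭-sym (bind-distrib ys (f x) (λ y → xs >>= λ x' → f x' y)))

    applyUpTo-cong : ∀ n {f g : ℕ → A} → (∀ i → i < n → f i ≡ g i) → applyUpTo f n ≡ applyUpTo g n
    applyUpTo-cong zero _ = refl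
    applyUpTo-cong (suc n) f≗g = cong₂ _∷_ (f≗g 0 z<s) (applyUpTo-cong n (λ i i<n → f≗g (suc i) (s<s i<n)))

    applyUpTo-+ : (f : ℕ → A) (m n : ℕ) → applyUpTo f (m + n) ≡ applyUpTo f m ++ applyUpTo (λ i → f (m + i)) n
    applyUpTo-+ f zero n = refl
    applyUpTo-+ f (suc m) n = cong (f 0 ∷_) (applyUpTo-+ (λ i → f (suc i)) m n)

    bind-upTo-cong : ∀ n {f g : ℕ → List B} → (∀ i → i < n → f i ≡ g i) → (upTo n >>= f) ≡ (upTo n >>= g)
    bind-upTo-cong n {f} {g} f≗g = cong concat (trans (map-upTo f n) (trans (applyUpTo-cong n f≗g) (sym (map-upTo g n))))

    pairWith : (A → B → C) → List A → List B → List C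
    pairWith f xs ys = xs >>= λ x → map (f x) ys

    pairWith-cong : (f : A → B → C) {xs xs′ : List A} {ys ys′ : List B} →
      xs ↭ xs′ → ys ↭ ys′ → pairWith f xs ys ↭ pairWith f xs′ ys′
    pairWith-cong f xs↭ ys↭ = bind-cong xs↭ (λ x → ↭-map⁺ (f x) ys↭)

    pairWith-bind : {A B C D E : Set a} (f : A → B → C) (xs : List D) (ys : List E) (F : D → List A) (G : E → List B) →
      pairWith f (xs >>= F) (ys >>= G) ↭ (xs >>= λ u → ys >>= λ v → pairWith f (F u) (G v))
    pairWith-bind f xs ys F G = begin
        ((xs >>= F) >>= λ x → map (f x) (ys >>= G))
      ≡⟨ bind-assoc xs F _ ⟩
        (xs >>= λ u → F u >>= λ x → map (f x) (ys >>= G))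
      ≡⟨ concatMap-cong (λ u → concatMap-cong (λ x → map-concatMap (f x) G ys) (F u)) xs ⟩
        (xs >>= λ u → F u >>= λ x → ys >>= λ v → map (f x) (G v))
      ↭⟨ bind-congʳ xs (λ u → bind-comm (F u) ys _) ⟩
        (xs >>= λ u → ys >>= λ v → pairWith f (F u) (G v))
      ∎
      where open PermutationReasoning

  -- Splitting a binary node at leaf i: the leaves 0..|l| lie in the left subtree, the
  -- leaves |l|+1.. in the right one.  This arithmetic is shared by unpainted trees
  -- (nd, splitT) and by the painted part of painted trees (pn, psplit), so it is
  -- developed once for any node constructor whose splitting follows this recursion.
  module NodeSplitting
    {X : Set} (size : X → ℕ) (node : X → X → X) (split : ℕ → X → X × X)
    (size-node : ∀ l r → size (node l r) ≡ suc (size l + size r))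
    (split-node : ∀ i l r → split i (node l r) ≡
       (if i ≤ᵇ size l
        then (proj₁ (split i l) , node (proj₂ (split i l)) r)
        else (node l (proj₁ (split (i ∸ suc (size l)) r)) , proj₂ (split (i ∸ suc (size l)) r))))
    where

    graftRight : X → X × X → X × X
    graftRight r (a , b) = (a , node b r)

    graftLeft : X → X × X → X × X
    graftLeft l (a , b) = (node l a , b)

    private
      m+n≮ᵇm : ∀ m n → (m + n <ᵇ m) ≡ false
      m+n≮ᵇm zero n = refl
      m+n≮ᵇm (suc m) n = m+n≮ᵇm m n

    split-left : ∀ i l r → i ≤ size l → split i (node l r) ≡ graftRight r (split i l)
    split-left i l r i≤l rewrite split-node i l r | Equivalence.to T-≡ (≤⇒≤ᵇ i≤l) = refl

    split-right : ∀ j l r → split (suc (size l + j)) (node l r) ≡ graftLeft l (split j r)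
    split-right j l r rewrite split-node (suc (size l + j)) l r | m+n≮ᵇm (size l) j | m+n∸m≡n (size l) j = refl

    open ListFacts using (applyUpTo-cong; applyUpTo-+)

    enumerate : X → List (X × X)
    enumerate x = applyUpTo (λ i → split i x) (suc (size x))

    enumerate-node : ∀ l r →
      enumerate (node l r) ≡ map (graftRight r) (enumerate l) ++ map (graftLeft l) (enumerate r)
    enumerate-node l r = begin
        applyUpTo (λ i → split i (node l r)) (suc (size (node l r)))
      ≡⟨ cong (applyUpTo (λ i → split i (node l r))) size+1 ⟩
        applyUpTo (λ i → split i (node l r)) (suc (size l) + suc (size r))
      ≡⟨ applyUpTo-+ (λ i → split i (node l r)) (suc (size l)) (suc (size r)) ⟩
        applyUpTo (λ i → split i (node l r)) (suc (size l)) ++ applyUpTo (λ j → split (suc (size l + j)) (node l r)) (suc (size r))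
      ≡⟨ cong₂ _++_ (applyUpTo-cong (suc (size l)) (λ i i≤l → split-left i l r (s≤s⁻¹ i≤l)))
                    (applyUpTo-cong (suc (size r)) (λ j _ → split-right j l r)) ⟩
        applyUpTo (λ i → graftRight r (split i l)) (suc (size l)) ++ applyUpTo (λ j → graftLeft l (split j r)) (suc (size r))
      ≡⟨ sym (cong₂ _++_ (map-applyUpTo (λ i → split i l) (graftRight r) (suc (size l))) (map-applyUpTo (λ j → split j r) (graftLeft l) (suc (size r)))) ⟩
        map (graftRight r) (enumerate l) ++ map (graftLeft l) (enumerate r)
      ∎
      where
        open ≡-Reasoning
        size+1 : suc (size (node l r)) ≡ suc (size l) + suc (size r)
        size+1 = cong suc (trans (size-node l r) (sym (+-suc (size l) (size r))))

    private
      leftOrRight : ∀ i m → i ≤ m ⊎ ∃ λ j → i ≡ suc (m + j)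
      leftOrRight zero m = inj₁ z≤n
      leftOrRight (suc i) zero = inj₂ (i , refl)
      leftOrRight (suc i) (suc m) with leftOrRight i m
      ... | inj₁ i≤m = inj₁ (s≤s i≤m)
      ... | inj₂ (j , refl) = inj₂ (j , refl)

    split-size-node : ∀ l r →
      (∀ i → i ≤ size l → size (proj₁ (split i l)) ≡ i) →
      (∀ i → i ≤ size r → size (proj₁ (split i r)) ≡ i) →
      ∀ i → i ≤ size (node l r) → size (proj₁ (split i (node l r))) ≡ i
    split-size-node l r size-l size-r i i≤ with leftOrRight i (size l)
    ... | inj₁ i≤l = trans (cong (λ ab → size (proj₁ ab)) (split-left i l r i≤l)) (size-l i i≤l)
    ... | inj₂ (j , refl) = begin
        size (proj₁ (split (suc (size l + j)) (node l r)))
      ≡⟨ cong (λ ab → size (proj₁ ab)) (split-right j l r) ⟩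
        size (node l (proj₁ (split j r)))
      ≡⟨ trans (size-node l _) (cong (λ k → suc (size l + k)) (size-r j j≤r)) ⟩
        suc (size l + j)
      ∎
      where
        open ≡-Reasoning
        j≤r : j ≤ size r
        j≤r = +-cancelˡ-≤ (size l) j (size r) (s≤s⁻¹ (subst (suc (size l + j) ≤_) (size-node l r) i≤))

    split-last-node : ∀ {e} l r → split (size r) r ≡ (r , e) → split (size (node l r)) (node l r) ≡ (node l r , e)
    split-last-node l r last-r rewrite size-node l r = trans (split-right (size r) l r) (cong (graftLeft l) last-r)

  -- These recursive enumerations are what the algebraic
  -- arguments below induct over; the leaf-indexed enumerations of Defs agree with them.
  module Splitting where

    module T = NodeSplitting size nd splitT (λ _ _ → refl) (λ _ _ _ → refl)
    module P = NodeSplitting psize pn psplit (λ _ _ → refl) (λ _ _ _ → refl)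

    splitsT : Tree → List (Tree × Tree)
    splitsT lf = (lf , lf) ∷ []
    splitsT (nd l r) = map (T.graftRight r) (splitsT l) ++ map (T.graftLeft l) (splitsT r)

    unpainted : Tree × Tree → PTree × PTree
    unpainted (a , b) = (un a , un b)

    splits : PTree → List (PTree × PTree)
    splits (un t) = map unpainted (splitsT t)
    splits (pn l r) = map (P.graftRight r) (splits l) ++ map (P.graftLeft l) (splits r)

    enumerateT-splitsT : ∀ t → T.enumerate t ≡ splitsT t
    enumerateT-splitsT lf = refl
    enumerateT-splitsT (nd l r) =
      trans (T.enumerate-node l r) (cong₂ (λ xs ys → map (T.graftRight r) xs ++ map (T.graftLeft l) ys)
                                          (enumerateT-splitsT l) (enumerateT-splitsT r))

    psplits-splits : ∀ p → map (λ i → psplit i p) (upTo (suc (psize p))) ≡ splits p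
    psplits-splits p = trans (map-upTo (λ i → psplit i p) (suc (psize p))) (enumerate-splits p)
      where
        enumerate-splits : ∀ p → P.enumerate p ≡ splits p
        enumerate-splits (un t) =
          trans (sym (map-applyUpTo (λ i → splitT i t) unpainted (suc (size t)))) (cong (map unpainted) (enumerateT-splitsT t))
        enumerate-splits (pn l r) =
          trans (P.enumerate-node l r) (cong₂ (λ xs ys → map (P.graftRight r) xs ++ map (P.graftLeft l) ys)
                                              (enumerate-splits l) (enumerate-splits r))

    psplit-size : ∀ i p → i ≤ psize p → psize (proj₁ (psplit i p)) ≡ i
    psplit-size i (un t) = splitT-size i t
      where
        splitT-size : ∀ i t → i ≤ size t → size (proj₁ (splitT i t)) ≡ i
        splitT-size i lf z≤n = refl
        splitT-size i (nd l r) = T.split-size-node l r (λ j → splitT-size j l) (λ j → splitT-size j r) i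
    psplit-size i (pn l r) = P.split-size-node l r (λ j → psplit-size j l) (λ j → psplit-size j r) i

    psplit-last : ∀ p → psplit (psize p) p ≡ (p , un lf)
    psplit-last (un t) = cong unpainted (splitT-last t)
      where
        splitT-last : ∀ t → splitT (size t) t ≡ (t , lf)
        splitT-last lf = refl
        splitT-last (nd l r) = T.split-last-node l r (splitT-last r)
    psplit-last (pn l r) = P.split-last-node l r (psplit-last r)

    forget² : PTree × PTree → Tree × Tree
    forget² (a , b) = (forget a , forget b)

    splits-forget : ∀ p → map forget² (splits p) ≡ splitsT (forget p)
    splits-forget (un t) = trans (sym (map-∘ (splitsT t))) (map-id (splitsT t))
    splits-forget (pn l r) = begin
        map forget² (map (P.graftRight r) (splits l) ++ map (P.graftLeft l) (splits r))
      ≡⟨ map-++ forget² (map (P.graftRight r) (splits l)) _ ⟩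
        map forget² (map (P.graftRight r) (splits l)) ++ map forget² (map (P.graftLeft l) (splits r))
      ≡⟨ cong₂ _++_ (trans (sym (map-∘ (splits l))) (map-∘ (splits l))) (trans (sym (map-∘ (splits r))) (map-∘ (splits r))) ⟩
        map (T.graftRight (forget r)) (map forget² (splits l)) ++ map (T.graftLeft (forget l)) (map forget² (splits r))
      ≡⟨ cong₂ (λ xs ys → map (T.graftRight (forget r)) xs ++ map (T.graftLeft (forget l)) ys) (splits-forget l) (splits-forget r) ⟩
        splitsT (forget (pn l r))
      ∎
      where open ≡-Reasoning

    psize-forget : ∀ p → psize p ≡ size (forget p)
    psize-forget (un t) = refl
    psize-forget (pn l r) = cong₂ (λ a b → suc (a + b)) (psize-forget l) (psize-forget r)

  -- It is stated against an arbitrary continuation G, the form in which it is used.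
  module NodeCoassociativity
    {X : Set} (node : X → X → X) (S : X → List (X × X))
    (S-node : ∀ l r → S (node l r) ≡
       map (λ ab → (proj₁ ab , node (proj₂ ab) r)) (S l) ++ map (λ ab → (node l (proj₁ ab) , proj₂ ab)) (S r))
    where

    open ListFacts
    open import Data.List.Relation.Binary.Permutation.Propositional using (_↭_; ↭-trans; ↭-sym; module PermutationReasoning)
    open import Data.List.Relation.Binary.Permutation.Propositional.Properties using (++⁺; ++⁺ˡ; ++⁺ʳ) renaming (++-assoc to ↭-++-assoc)
    open import Data.List.Properties using (concatMap-++; concatMap-map; concatMap-cong)

    Coassociative : X → Set₁
    Coassociative p = ∀ {B : Set} (G : X → X → X → List B) →
      (S p >>= λ ab → S (proj₁ ab) >>= λ cd → G (proj₁ cd) (proj₂ cd) (proj₂ ab)) ↭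
      (S p >>= λ ab → S (proj₂ ab) >>= λ cd → G (proj₁ ab) (proj₁ cd) (proj₂ cd))

    bind-node : ∀ {B : Set} l r (H : X → X → List B) →
      (S (node l r) >>= λ ab → H (proj₁ ab) (proj₂ ab)) ≡
      (S l >>= λ ab → H (proj₁ ab) (node (proj₂ ab) r)) ++ (S r >>= λ ab → H (node l (proj₁ ab)) (proj₂ ab))
    bind-node l r H = trans (cong (concatMap (λ ab → H (proj₁ ab) (proj₂ ab))) (S-node l r))
      (trans (concatMap-++ _ (map _ (S l)) (map _ (S r)))
        (cong₂ _++_ (concatMap-map _ _ (S l)) (concatMap-map _ _ (S r))))

    -- Both iterated splittings of node l r fall into three parts: the triples cut
    -- inside l, those cut once in l and once in r, and those cut inside r.
    module _ (l r : X) {B : Set} (G : X → X → X → List B) where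

      insideˡ insideˡ′ cross cross′ insideʳ insideʳ′ : List B
      insideˡ = S l >>= λ ab → S (proj₁ ab) >>= λ cd → G (proj₁ cd) (proj₂ cd) (node (proj₂ ab) r)
      insideˡ′ = S l >>= λ ab → S (proj₂ ab) >>= λ cd → G (proj₁ ab) (proj₁ cd) (node (proj₂ cd) r)
      cross = S r >>= λ ab → S l >>= λ cd → G (proj₁ cd) (node (proj₂ cd) (proj₁ ab)) (proj₂ ab)
      cross′ = S l >>= λ ab → S r >>= λ cd → G (proj₁ ab) (node (proj₂ ab) (proj₁ cd)) (proj₂ cd)
      insideʳ = S r >>= λ ab → S (proj₁ ab) >>= λ cd → G (node l (proj₁ cd)) (proj₂ cd) (proj₂ ab)
      insideʳ′ = S r >>= λ ab → S (proj₂ ab) >>= λ cd → G (node l (proj₁ ab)) (proj₁ cd) (proj₂ cd)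

      split-then-splitˡ : (S (node l r) >>= λ ab → S (proj₁ ab) >>= λ cd → G (proj₁ cd) (proj₂ cd) (proj₂ ab)) ↭
                          insideˡ ++ (cross ++ insideʳ)
      split-then-splitˡ = begin
          (S (node l r) >>= λ ab → S (proj₁ ab) >>= λ cd → G (proj₁ cd) (proj₂ cd) (proj₂ ab))
        ≡⟨ bind-node l r (λ a b → S a >>= λ cd → G (proj₁ cd) (proj₂ cd) b) ⟩
          insideˡ ++ (S r >>= λ ab → S (node l (proj₁ ab)) >>= λ cd → G (proj₁ cd) (proj₂ cd) (proj₂ ab))
        ≡⟨ cong (insideˡ ++_) (concatMap-cong (λ ab → bind-node l (proj₁ ab) (λ c d → G c d (proj₂ ab))) (S r)) ⟩
          insideˡ ++ (S r >>= λ ab → (S l >>= λ cd → G (proj₁ cd) (node (proj₂ cd) (proj₁ ab)) (proj₂ ab)) ++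
                                      (S (proj₁ ab) >>= λ cd → G (node l (proj₁ cd)) (proj₂ cd) (proj₂ ab)))
        ↭⟨ ++⁺ˡ insideˡ (bind-distrib (S r) _ _) ⟩
          insideˡ ++ (cross ++ insideʳ)
        ∎
        where open PermutationReasoning

      split-then-splitʳ : (S (node l r) >>= λ ab → S (proj₂ ab) >>= λ cd → G (proj₁ ab) (proj₁ cd) (proj₂ cd)) ↭
                          insideˡ′ ++ (cross′ ++ insideʳ′)
      split-then-splitʳ = begin
          (S (node l r) >>= λ ab → S (proj₂ ab) >>= λ cd → G (proj₁ ab) (proj₁ cd) (proj₂ cd))
        ≡⟨ bind-node l r (λ a b → S b >>= λ cd → G a (proj₁ cd) (proj₂ cd)) ⟩
          (S l >>= λ ab → S (node (proj₂ ab) r) >>= λ cd → G (proj₁ ab) (proj₁ cd) (proj₂ cd)) ++ insideʳ′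
        ≡⟨ cong (_++ insideʳ′) (concatMap-cong (λ ab → bind-node (proj₂ ab) r (G (proj₁ ab))) (S l)) ⟩
          (S l >>= λ ab → (S (proj₂ ab) >>= λ cd → G (proj₁ ab) (proj₁ cd) (node (proj₂ cd) r)) ++
                           (S r >>= λ cd → G (proj₁ ab) (node (proj₂ ab) (proj₁ cd)) (proj₂ cd))) ++ insideʳ′
        ↭⟨ ++⁺ʳ insideʳ′ (bind-distrib (S l) _ _) ⟩
          (insideˡ′ ++ cross′) ++ insideʳ′
        ↭⟨ ↭-++-assoc insideˡ′ cross′ insideʳ′ ⟩
          insideˡ′ ++ (cross′ ++ insideʳ′)
        ∎
        where open PermutationReasoning

    -- the inside parts match by induction, the cross parts by exchanging the two
    -- independent splittings of l and r
    coassociative-node : ∀ l r → Coassociative l → Coassociative r → Coassociative (node l r)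
    coassociative-node l r coassoc-l coassoc-r G =
      ↭-trans (split-then-splitˡ l r G)
        (↭-trans (++⁺ (coassoc-l (λ c d z → G c d (node z r)))
                      (++⁺ (bind-comm (S r) (S l) (λ ab cd → G (proj₁ cd) (node (proj₂ cd) (proj₁ ab)) (proj₂ ab)))
                           (coassoc-r (λ c d z → G (node l c) d z))))
                 (↭-sym (split-then-splitʳ l r G)))

  module Coassociativity where

    open Splitting
    open ListFacts
    open import Data.List.Relation.Binary.Permutation.Propositional using (↭-refl; module PermutationReasoning)
    open import Data.List.Properties using (concatMap-map; concatMap-cong)

    module CT = NodeCoassociativity nd splitsT (λ _ _ → refl)
    module CP = NodeCoassociativity pn splits (λ _ _ → refl)

    splitsT-coassociative : ∀ t → CT.Coassociative t
    splitsT-coassociative lf G = ↭-refl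
    splitsT-coassociative (nd l r) = CT.coassociative-node l r (splitsT-coassociative l) (splitsT-coassociative r)

    splits-coassociative : ∀ p → CP.Coassociative p
    splits-coassociative (un t) G = begin
        (splits (un t) >>= λ ab → splits (proj₁ ab) >>= λ cd → G (proj₁ cd) (proj₂ cd) (proj₂ ab))
      ≡⟨ trans (bind-un t _) (concatMap-cong (λ ab → bind-un (proj₁ ab) _) (splitsT t)) ⟩
        (splitsT t >>= λ ab → splitsT (proj₁ ab) >>= λ cd → G (un (proj₁ cd)) (un (proj₂ cd)) (un (proj₂ ab)))
      ↭⟨ splitsT-coassociative t (λ x y z → G (un x) (un y) (un z)) ⟩
        (splitsT t >>= λ ab → splitsT (proj₂ ab) >>= λ cd → G (un (proj₁ ab)) (un (proj₁ cd)) (un (proj₂ cd)))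
      ≡⟨ sym (trans (bind-un t _) (concatMap-cong (λ ab → bind-un (proj₂ ab) _) (splitsT t))) ⟩
        (splits (un t) >>= λ ab → splits (proj₂ ab) >>= λ cd → G (proj₁ ab) (proj₁ cd) (proj₂ cd))
      ∎
      where
        open PermutationReasoning
        bind-un : ∀ {B : Set} t (H : PTree → PTree → List B) →
          (splits (un t) >>= λ ab → H (proj₁ ab) (proj₂ ab)) ≡ (splitsT t >>= λ ab → H (un (proj₁ ab)) (un (proj₂ ab)))
        bind-un t H = concatMap-map _ unpainted (splitsT t)
    splits-coassociative (pn l r) = CP.coassociative-node l r (splits-coassociative l) (splits-coassociative r)

  -- The product F_p · F_q depends on q only through its shape Q = forget q and is
  -- computed recursively along Q: F_p · F_lf = F_p, and the trees of F_p · F_(nd Q₁ Q₂)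
  -- are the pn x y with x in F_a · F_Q₁ and y in F_b · F_Q₂, over all splittings
  -- (a , b) of p.  This agrees, up to order, with the multi-splitting-and-grafting
  -- definition prodTrees of Defs.
  module Product where

    open Splitting
    open Coassociativity using (splits-coassociative)
    open ListFacts
    open import Data.List using (length; take; drop; concat)
    open import Data.List.Properties using (concatMap-map; concatMap-cong; map-concatMap; map-cong-local)
    open import Data.List.Relation.Unary.All as All using (All; []; _∷_)
    import Data.List.Relation.Unary.All.Properties as All
    open import Data.List.Relation.Binary.Permutation.Propositional using (_↭_; ↭-refl; ↭-sym; ↭-reflexive; module PermutationReasoning)
    open import Data.List.Relation.Binary.Permutation.Propositional.Properties using () renaming (map⁺ to ↭-map⁺)

    prod : PTree → Tree → List PTree
    prod p lf = [ p ]
    prod p (nd Q₁ Q₂) = splits p >>= λ ab → pairWith pn (prod (proj₁ ab) Q₁) (prod (proj₂ ab) Q₂)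

    msplit-suc : ∀ r p → msplit (suc r) p ≡ (splits p >>= λ ab → map (proj₁ ab ∷_) (msplit r (proj₂ ab)))
    msplit-suc r p = trans (sym (concatMap-map (λ ab → map (proj₁ ab ∷_) (msplit r (proj₂ ab))) (λ i → psplit i p) (upTo (suc (psize p)))))
                           (cong (concatMap (λ ab → map (proj₁ ab ∷_) (msplit r (proj₂ ab)))) (psplits-splits p))

    -- Splitting at m + 1 + k leaves amounts to cutting once (at the (m+1)-st chosen
    -- leaf), then splitting the left piece at m and the right piece at k leaves.
    msplit-+ : ∀ m k p → msplit (m + suc k) p ↭
      (splits p >>= λ ab → msplit m (proj₁ ab) >>= λ x → map (x ++_) (msplit k (proj₂ ab)))
    msplit-+ zero k p = ↭-reflexive (trans (msplit-suc k p)
       (concatMap-cong (λ ab → sym (++-identityʳ (map (proj₁ ab ∷_) (msplit k (proj₂ ab))))) (splits p)))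
    msplit-+ (suc m) k p = begin
        msplit (suc (m + suc k)) p
      ≡⟨ msplit-suc (m + suc k) p ⟩
        (splits p >>= λ ab → map (proj₁ ab ∷_) (msplit (m + suc k) (proj₂ ab)))
      ↭⟨ bind-congʳ (splits p) (λ ab → ↭-map⁺ (proj₁ ab ∷_) (msplit-+ m k (proj₂ ab))) ⟩
        (splits p >>= λ ab → map (proj₁ ab ∷_) (splits (proj₂ ab) >>= λ cd → msplit m (proj₁ cd) >>= λ x → map (x ++_) (msplit k (proj₂ cd))))
      ≡⟨ concatMap-cong (λ ab → trans (map-concatMap (proj₁ ab ∷_) _ (splits (proj₂ ab)))
           (concatMap-cong (λ cd → trans (map-concatMap (proj₁ ab ∷_) _ (msplit m (proj₁ cd)))
             (concatMap-cong (λ x → sym (map-∘ (msplit k (proj₂ cd)))) (msplit m (proj₁ cd)))) (splits (proj₂ ab)))) (splits p) ⟩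
        (splits p >>= λ ab → splits (proj₂ ab) >>= λ cd → G (proj₁ ab) (proj₁ cd) (proj₂ cd))
      ↭⟨ ↭-sym (splits-coassociative p G) ⟩
        (splits p >>= λ ab → splits (proj₁ ab) >>= λ cd → G (proj₁ cd) (proj₂ cd) (proj₂ ab))
      ≡⟨ concatMap-cong (λ ab → sym (trans (cong (concatMap (λ x → map (x ++_) (msplit k (proj₂ ab)))) (msplit-suc m (proj₁ ab)))
            (trans (bind-assoc (splits (proj₁ ab)) _ _)
              (concatMap-cong (λ cd → concatMap-map _ (proj₁ cd ∷_) (msplit m (proj₂ cd))) (splits (proj₁ ab)))))) (splits p) ⟩
        (splits p >>= λ ab → msplit (suc m) (proj₁ ab) >>= λ x → map (x ++_) (msplit k (proj₂ ab)))
      ∎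
      where
        open PermutationReasoning
        G : PTree → PTree → PTree → List (List PTree)
        G a c d = msplit m c >>= λ x → map (λ y → a ∷ (x ++ y)) (msplit k d)

    msplit-length : ∀ r p → All (λ x → length x ≡ suc r) (msplit r p)
    msplit-length zero p = refl ∷ []
    msplit-length (suc r) p = All.concat⁺ (All.map⁺ (All.tabulate {xs = upTo (suc (psize p))} λ {i} _ →
      cons-length (proj₁ (psplit i p)) (msplit-length r (proj₂ (psplit i p)))))
      where
        cons-length : ∀ a {xs : List (List PTree)} → All (λ x → length x ≡ suc r) xs → All (λ x → length x ≡ suc (suc r)) (map (a ∷_) xs)
        cons-length a lens = All.map⁺ (All.map (cong suc) lens)

    graft-node : ∀ x y Q₁ Q₂ → length x ≡ suc (size Q₁) → graft (x ++ y) (nd Q₁ Q₂) ≡ pn (graft x Q₁) (graft y Q₂)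
    graft-node x y Q₁ Q₂ len = cong₂ (λ a b → pn (graft a Q₁) (graft b Q₂)) (take-++ x len) (drop-++ x len)
      where
        take-++ : ∀ {n} x → length x ≡ n → take n (x ++ y) ≡ x
        take-++ [] refl = refl
        take-++ (a ∷ x) refl = cong (a ∷_) (take-++ x refl)
        drop-++ : ∀ {n} x → length x ≡ n → drop n (x ++ y) ≡ y
        drop-++ [] refl = refl
        drop-++ (a ∷ x) refl = drop-++ x refl

    graft-cut : ∀ Q₁ Q₂ a b →
      map (λ f → graft f (nd Q₁ Q₂)) (msplit (size Q₁) a >>= λ x → map (x ++_) (msplit (size Q₂) b)) ≡
      (map (λ f → graft f Q₁) (msplit (size Q₁) a) >>= λ x → map (pn x) (map (λ f → graft f Q₂) (msplit (size Q₂) b)))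
    graft-cut Q₁ Q₂ a b = begin
        map (λ f → graft f (nd Q₁ Q₂)) (msplit (size Q₁) a >>= λ x → map (x ++_) ys)
      ≡⟨ map-concatMap _ _ (msplit (size Q₁) a) ⟩
        (msplit (size Q₁) a >>= λ x → map (λ f → graft f (nd Q₁ Q₂)) (map (x ++_) ys))
      ≡⟨ cong concat (map-cong-local (All.map graft-halves (msplit-length (size Q₁) a))) ⟩
        (msplit (size Q₁) a >>= λ x → map (pn (graft x Q₁)) (map (λ f → graft f Q₂) ys))
      ≡⟨ sym (concatMap-map _ (λ f → graft f Q₁) (msplit (size Q₁) a)) ⟩
        (map (λ f → graft f Q₁) (msplit (size Q₁) a) >>= λ x → map (pn x) (map (λ f → graft f Q₂) ys))
      ∎
      where
        open ≡-Reasoning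
        ys = msplit (size Q₂) b
        graft-halves : ∀ {x} → length x ≡ suc (size Q₁) →
          map (λ f → graft f (nd Q₁ Q₂)) (map (x ++_) ys) ≡ map (pn (graft x Q₁)) (map (λ f → graft f Q₂) ys)
        graft-halves {x} len = trans (sym (map-∘ ys)) (trans (map-cong (λ y → graft-node x y Q₁ Q₂ len) ys) (map-∘ ys))

    graft-msplit : ∀ Q p → map (λ f → graft f Q) (msplit (size Q) p) ↭ prod p Q
    graft-msplit lf p = ↭-refl
    graft-msplit (nd Q₁ Q₂) p = begin
        map (λ f → graft f (nd Q₁ Q₂)) (msplit (suc (size Q₁ + size Q₂)) p)
      ≡⟨ cong (λ n → map (λ f → graft f (nd Q₁ Q₂)) (msplit n p)) (sym (+-suc (size Q₁) (size Q₂))) ⟩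
        map (λ f → graft f (nd Q₁ Q₂)) (msplit (size Q₁ + suc (size Q₂)) p)
      ↭⟨ ↭-map⁺ _ (msplit-+ (size Q₁) (size Q₂) p) ⟩
        map (λ f → graft f (nd Q₁ Q₂)) (splits p >>= λ ab → msplit (size Q₁) (proj₁ ab) >>= λ x → map (x ++_) (msplit (size Q₂) (proj₂ ab)))
      ≡⟨ trans (map-concatMap _ _ (splits p)) (concatMap-cong (λ ab → graft-cut Q₁ Q₂ (proj₁ ab) (proj₂ ab)) (splits p)) ⟩
        (splits p >>= λ ab → map (λ f → graft f Q₁) (msplit (size Q₁) (proj₁ ab)) >>= λ x →
                             map (pn x) (map (λ f → graft f Q₂) (msplit (size Q₂) (proj₂ ab))))
      ↭⟨ bind-congʳ (splits p) (λ ab → bind-cong (graft-msplit Q₁ (proj₁ ab)) (λ x → ↭-map⁺ (pn x) (graft-msplit Q₂ (proj₂ ab)))) ⟩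
        prod p (nd Q₁ Q₂)
      ∎
      where open PermutationReasoning

    prodTrees-prod : ∀ p q → prodTrees p q ↭ prod p (forget q)
    prodTrees-prod p q = subst (λ n → map (λ f → graft f (forget q)) (msplit n p) ↭ prod p (forget q))
                               (sym (psize-forget q)) (graft-msplit (forget q) p)

  -- Splitting a product: the splittings of the trees of F_p · F_Q are, up to order,
  -- the pairs (x , y) with x in F_a · F_c and y in F_b · F_d, over all splittings
  -- (a , b) of p and (c , d) of Q.  This is the combinatorial core of Δ being
  -- multiplicative, and (via Δ's recursion in the product) of associativity.
  module SplittingProducts where

    open Splitting
    open Coassociativity using (splits-coassociative; module CT)
    open Product
    open ListFacts
    open import Data.List.Properties using (concatMap-map; concatMap-cong; concatMap-pure)
    open import Data.List.Relation.Binary.Permutation.Propositional using (_↭_; ↭-sym; ↭-trans; ↭-reflexive; module PermutationReasoning)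
    open import Data.List.Relation.Binary.Permutation.Propositional.Properties using (++⁺)

    prodPairs : PTree × PTree → Tree × Tree → List (PTree × PTree)
    prodPairs ab cd = pairWith _,_ (prod (proj₁ ab) (proj₁ cd)) (prod (proj₂ ab) (proj₂ cd))

    splitProd : PTree → Tree → List (PTree × PTree)
    splitProd p Q = splits p >>= λ ab → splitsT Q >>= λ cd → prodPairs ab cd

    bind-splitProd : ∀ {B : Set} p Q (K : PTree → PTree → List B) →
      (splitProd p Q >>= λ uv → K (proj₁ uv) (proj₂ uv)) ≡
      (splits p >>= λ ab → splitsT Q >>= λ cd → prod (proj₁ ab) (proj₁ cd) >>= λ u → prod (proj₂ ab) (proj₂ cd) >>= λ v → K u v)
    bind-splitProd p Q K = trans (bind-assoc (splits p) _ _) (concatMap-cong (λ ab → trans (bind-assoc (splitsT Q) _ _)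
      (concatMap-cong (λ cd → trans (bind-assoc (prod (proj₁ ab) (proj₁ cd)) _ _)
         (concatMap-cong (λ u → concatMap-map _ _ (prod (proj₂ ab) (proj₂ cd))) (prod (proj₁ ab) (proj₁ cd)))) (splitsT Q))) (splits p))

    SplitsProd : Tree → Set
    SplitsProd Q = ∀ p → (prod p Q >>= splits) ↭ splitProd p Q

    module _ (Q₁ Q₂ : Tree) where

      cutLeft cutRight : PTree × PTree → List (PTree × PTree)
      cutLeft ab = prod (proj₁ ab) Q₁ >>= λ x → prod (proj₂ ab) Q₂ >>= λ y → map (λ uv → (proj₁ uv , pn (proj₂ uv) y)) (splits x)
      cutRight ab = prod (proj₁ ab) Q₁ >>= λ x → prod (proj₂ ab) Q₂ >>= λ y → map (λ uv → (pn x (proj₁ uv) , proj₂ uv)) (splits y)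

      splits-prod-node : ∀ p → (prod p (nd Q₁ Q₂) >>= splits) ↭ (splits p >>= cutLeft) ++ (splits p >>= cutRight)
      splits-prod-node p = begin
          (prod p (nd Q₁ Q₂) >>= splits)
        ≡⟨ trans (bind-assoc (splits p) _ _) (concatMap-cong (λ ab → trans (bind-assoc (prod (proj₁ ab) Q₁) _ _)
             (concatMap-cong (λ x → concatMap-map splits (pn x) (prod (proj₂ ab) Q₂)) (prod (proj₁ ab) Q₁))) (splits p)) ⟩
          (splits p >>= λ ab → prod (proj₁ ab) Q₁ >>= λ x → prod (proj₂ ab) Q₂ >>= λ y → splits (pn x y))
        ↭⟨ bind-congʳ (splits p) (λ ab → ↭-trans (bind-congʳ (prod (proj₁ ab) Q₁) (λ x → bind-distrib (prod (proj₂ ab) Q₂) _ _))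
             (bind-distrib (prod (proj₁ ab) Q₁) _ _)) ⟩
          (splits p >>= λ ab → cutLeft ab ++ cutRight ab)
        ↭⟨ bind-distrib (splits p) cutLeft cutRight ⟩
          (splits p >>= cutLeft) ++ (splits p >>= cutRight)
        ∎
        where open PermutationReasoning

      -- cutting inside the left factor: by induction for Q₁, then coassociativity of
      -- splitting p regroups the right pieces into products over nd d Q₂
      splits-cutLeft : SplitsProd Q₁ → ∀ p →
        (splits p >>= cutLeft) ↭ (splits p >>= λ ab → splitsT Q₁ >>= λ ef → prodPairs ab (proj₁ ef , nd (proj₂ ef) Q₂))
      splits-cutLeft splits-prod₁ p = begin
          (splits p >>= cutLeft)
        ↭⟨ bind-congʳ (splits p) (λ ab → bind-congʳ (prod (proj₁ ab) Q₁) (λ x →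
             ↭-trans (↭-reflexive (concatMap-cong (λ y → map-as-bind (splits x) _) (prod (proj₂ ab) Q₂)))
                     (bind-comm (prod (proj₂ ab) Q₂) (splits x) (λ y uv → [ (proj₁ uv , pn (proj₂ uv) y) ])))) ⟩
          (splits p >>= λ ab → prod (proj₁ ab) Q₁ >>= λ x → splits x >>= λ uv → W (proj₁ uv) (proj₂ uv) (proj₂ ab))
        ≡⟨ concatMap-cong (λ ab → sym (bind-assoc (prod (proj₁ ab) Q₁) splits _)) (splits p) ⟩
          (splits p >>= λ ab → (prod (proj₁ ab) Q₁ >>= splits) >>= λ uv → W (proj₁ uv) (proj₂ uv) (proj₂ ab))
        ↭⟨ bind-congʳ (splits p) (λ ab → bind-congˡ _ (splits-prod₁ (proj₁ ab))) ⟩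
          (splits p >>= λ ab → splitProd (proj₁ ab) Q₁ >>= λ uv → W (proj₁ uv) (proj₂ uv) (proj₂ ab))
        ≡⟨ concatMap-cong (λ ab → bind-splitProd (proj₁ ab) Q₁ (λ u v → W u v (proj₂ ab))) (splits p) ⟩
          (splits p >>= λ ab → splits (proj₁ ab) >>= λ cd → H (proj₁ cd) (proj₂ cd) (proj₂ ab))
        ↭⟨ splits-coassociative p H ⟩
          (splits p >>= λ ab → splits (proj₂ ab) >>= λ cd → H (proj₁ ab) (proj₁ cd) (proj₂ cd))
        ↭⟨ bind-congʳ (splits p) (λ ab → ↭-trans (bind-comm (splits (proj₂ ab)) (splitsT Q₁) _)
              (bind-congʳ (splitsT Q₁) (λ ef → bind-comm (splits (proj₂ ab)) (prod (proj₁ ab) (proj₁ ef)) _))) ⟩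
          (splits p >>= λ ab → splitsT Q₁ >>= λ ef → prod (proj₁ ab) (proj₁ ef) >>= λ u →
             splits (proj₂ ab) >>= λ cd → prod (proj₁ cd) (proj₂ ef) >>= λ v → W u v (proj₂ cd))
        ≡⟨ concatMap-cong (λ ab → concatMap-cong (λ ef → concatMap-cong (λ u →
             sym (rightFactor (proj₂ ab) (proj₂ ef) u)) (prod (proj₁ ab) (proj₁ ef))) (splitsT Q₁)) (splits p) ⟩
          (splits p >>= λ ab → splitsT Q₁ >>= λ ef → prodPairs ab (proj₁ ef , nd (proj₂ ef) Q₂))
        ∎
        where
          open PermutationReasoning
          W : PTree → PTree → PTree → List (PTree × PTree)
          W u v b = prod b Q₂ >>= λ y → [ (u , pn v y) ]
          H : PTree → PTree → PTree → List (PTree × PTree)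
          H a c d = splitsT Q₁ >>= λ ef → prod a (proj₁ ef) >>= λ u → prod c (proj₂ ef) >>= λ v → W u v d
          rightFactor : ∀ b d u → map (λ y → (u , y)) (prod b (nd d Q₂)) ≡
            (splits b >>= λ cd → prod (proj₁ cd) d >>= λ v → W u v (proj₂ cd))
          rightFactor b d u = trans (map-as-bind (prod b (nd d Q₂)) _)
            (trans (bind-assoc (splits b) _ _) (concatMap-cong (λ cd →
              trans (bind-assoc (prod (proj₁ cd) d) _ _) (concatMap-cong (λ v →
                concatMap-map _ (pn v) (prod (proj₂ cd) Q₂)) (prod (proj₁ cd) d))) (splits b)))

      -- cutting inside the right factor: by induction for Q₂, then coassociativity of
      -- splitting p regroups the left pieces into products over nd Q₁ c
      splits-cutRight : SplitsProd Q₂ → ∀ p →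
        (splits p >>= cutRight) ↭ (splits p >>= λ ab → splitsT Q₂ >>= λ ef → prodPairs ab (nd Q₁ (proj₁ ef) , proj₂ ef))
      splits-cutRight splits-prod₂ p = begin
          (splits p >>= cutRight)
        ≡⟨ concatMap-cong (λ ab → concatMap-cong (λ x →
             trans (concatMap-cong (λ y → map-as-bind (splits y) _) (prod (proj₂ ab) Q₂))
                   (sym (bind-assoc (prod (proj₂ ab) Q₂) splits _))) (prod (proj₁ ab) Q₁)) (splits p) ⟩
          (splits p >>= λ ab → prod (proj₁ ab) Q₁ >>= λ x → (prod (proj₂ ab) Q₂ >>= splits) >>= λ uv → [ (pn x (proj₁ uv) , proj₂ uv) ])
        ↭⟨ bind-congʳ (splits p) (λ ab → bind-congʳ (prod (proj₁ ab) Q₁) (λ x → bind-congˡ _ (splits-prod₂ (proj₂ ab)))) ⟩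
          (splits p >>= λ ab → prod (proj₁ ab) Q₁ >>= λ x → splitProd (proj₂ ab) Q₂ >>= λ uv → [ (pn x (proj₁ uv) , proj₂ uv) ])
        ≡⟨ concatMap-cong (λ ab → concatMap-cong (λ x → bind-splitProd (proj₂ ab) Q₂ (λ u v → [ (pn x u , v) ])) (prod (proj₁ ab) Q₁)) (splits p) ⟩
          (splits p >>= λ ab → prod (proj₁ ab) Q₁ >>= λ x → splits (proj₂ ab) >>= λ cd → H′ x (proj₁ cd) (proj₂ cd))
        ↭⟨ bind-congʳ (splits p) (λ ab → bind-comm (prod (proj₁ ab) Q₁) (splits (proj₂ ab)) _) ⟩
          (splits p >>= λ ab → splits (proj₂ ab) >>= λ cd → G (proj₁ ab) (proj₁ cd) (proj₂ cd))
        ↭⟨ ↭-sym (splits-coassociative p G) ⟩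
          (splits p >>= λ ab → splits (proj₁ ab) >>= λ cd → G (proj₁ cd) (proj₂ cd) (proj₂ ab))
        ↭⟨ bind-congʳ (splits p) (λ ab → ↭-trans (bind-congʳ (splits (proj₁ ab)) (λ cd → bind-comm (prod (proj₁ cd) Q₁) (splitsT Q₂) _))
              (bind-comm (splits (proj₁ ab)) (splitsT Q₂) _)) ⟩
          (splits p >>= λ ab → splitsT Q₂ >>= λ ef → splits (proj₁ ab) >>= λ cd → prod (proj₁ cd) Q₁ >>= λ x →
             H x (proj₂ cd) (proj₁ ef) (proj₂ ab) (proj₂ ef))
        ≡⟨ concatMap-cong (λ ab → concatMap-cong (λ ef → sym (leftFactor (proj₁ ab) (proj₁ ef) (proj₂ ab) (proj₂ ef))) (splitsT Q₂)) (splits p) ⟩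
          (splits p >>= λ ab → splitsT Q₂ >>= λ ef → prodPairs ab (nd Q₁ (proj₁ ef) , proj₂ ef))
        ∎
        where
          open PermutationReasoning
          H : PTree → PTree → Tree → PTree → Tree → List (PTree × PTree)
          H x c e d f = prod c e >>= λ u → prod d f >>= λ v → [ (pn x u , v) ]
          H′ : PTree → PTree → PTree → List (PTree × PTree)
          H′ x c d = splitsT Q₂ >>= λ ef → H x c (proj₁ ef) d (proj₂ ef)
          G : PTree → PTree → PTree → List (PTree × PTree)
          G x c d = prod x Q₁ >>= λ x' → H′ x' c d
          leftFactor : ∀ a e b f → prodPairs (a , b) (nd Q₁ e , f) ≡
            (splits a >>= λ cd → prod (proj₁ cd) Q₁ >>= λ x → H x (proj₂ cd) e b f)
          leftFactor a e b f = trans (bind-assoc (splits a) _ _) (concatMap-cong (λ cd →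
            trans (bind-assoc (prod (proj₁ cd) Q₁) _ _) (concatMap-cong (λ x →
              trans (concatMap-map _ (pn x) (prod (proj₂ cd) e))
                (concatMap-cong (λ u → map-as-bind (prod b f) _) (prod (proj₂ cd) e))) (prod (proj₁ cd) Q₁))) (splits a))

    splits-prod : ∀ Q → SplitsProd Q
    splits-prod lf p = ↭-reflexive (trans (++-identityʳ (splits p)) (sym (concatMap-pure (splits p))))
    splits-prod (nd Q₁ Q₂) p = begin
        (prod p (nd Q₁ Q₂) >>= splits)
      ↭⟨ splits-prod-node Q₁ Q₂ p ⟩
        (splits p >>= cutLeft Q₁ Q₂) ++ (splits p >>= cutRight Q₁ Q₂)
      ↭⟨ ++⁺ (splits-cutLeft Q₁ Q₂ (splits-prod Q₁) p) (splits-cutRight Q₁ Q₂ (splits-prod Q₂) p) ⟩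
        (splits p >>= λ ab → splitsT Q₁ >>= λ ef → prodPairs ab (proj₁ ef , nd (proj₂ ef) Q₂)) ++
        (splits p >>= λ ab → splitsT Q₂ >>= λ ef → prodPairs ab (nd Q₁ (proj₁ ef) , proj₂ ef))
      ↭⟨ ↭-sym (bind-distrib (splits p) _ _) ⟩
        (splits p >>= λ ab → (splitsT Q₁ >>= λ ef → prodPairs ab (proj₁ ef , nd (proj₂ ef) Q₂)) ++
                             (splitsT Q₂ >>= λ ef → prodPairs ab (nd Q₁ (proj₁ ef) , proj₂ ef)))
      ≡⟨ concatMap-cong (λ ab → sym (CT.bind-node Q₁ Q₂ (λ c d → prodPairs ab (c , d)))) (splits p) ⟩
        splitProd p (nd Q₁ Q₂)
      ∎
      where open PermutationReasoning

    splits-prod-forget : ∀ {B : Set} p q (K : PTree → PTree → List B) →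
      (prod p (forget q) >>= λ t → splits t >>= λ uv → K (proj₁ uv) (proj₂ uv)) ↭
      (splits p >>= λ ab → splits q >>= λ cd → prod (proj₁ ab) (forget (proj₁ cd)) >>= λ u → prod (proj₂ ab) (forget (proj₂ cd)) >>= λ v → K u v)
    splits-prod-forget p q K = begin
        (prod p (forget q) >>= λ t → splits t >>= λ uv → K (proj₁ uv) (proj₂ uv))
      ≡⟨ sym (bind-assoc (prod p (forget q)) splits _) ⟩
        ((prod p (forget q) >>= splits) >>= λ uv → K (proj₁ uv) (proj₂ uv))
      ↭⟨ bind-congˡ _ (splits-prod (forget q) p) ⟩
        (splitProd p (forget q) >>= λ uv → K (proj₁ uv) (proj₂ uv))
      ≡⟨ bind-splitProd p (forget q) K ⟩
        (splits p >>= λ ab → splitsT (forget q) >>= λ cd → prod (proj₁ ab) (proj₁ cd) >>= λ u → prod (proj₂ ab) (proj₂ cd) >>= λ v → K u v)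
      ≡⟨ concatMap-cong (λ ab → trans (cong (concatMap _) (sym (splits-forget q))) (concatMap-map _ forget² (splits q))) (splits p) ⟩
        (splits p >>= λ ab → splits q >>= λ cd → prod (proj₁ ab) (forget (proj₁ cd)) >>= λ u → prod (proj₂ ab) (forget (proj₂ cd)) >>= λ v → K u v)
      ∎
      where open PermutationReasoning

  -- By induction on the shape R of r: for R = nd R₁ R₂ both
  -- sides unfold, through the splitting of products, to pn-pairings over the
  -- splittings (a , b) of p and (c , d) of q, where the induction hypotheses apply.
  module Associativity where

    open Splitting
    open Product
    open SplittingProducts using (splits-prod-forget)
    open ListFacts
    open import Data.List.Properties using (concatMap-map; concatMap-cong; concatMap-pure)
    open import Data.List.Relation.Binary.Permutation.Propositional using (_↭_; ↭-sym; ↭-trans; ↭-reflexive; module PermutationReasoning)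

    prodProd-nodeˡ : ∀ R₁ R₂ p q → (prod p (forget q) >>= λ t → prod t (nd R₁ R₂)) ↭
      (splits p >>= λ ab → splits q >>= λ cd →
         pairWith pn (prod (proj₁ ab) (forget (proj₁ cd)) >>= λ u → prod u R₁) (prod (proj₂ ab) (forget (proj₂ cd)) >>= λ v → prod v R₂))
    prodProd-nodeˡ R₁ R₂ p q = begin
        (prod p (forget q) >>= λ t → prod t (nd R₁ R₂))
      ↭⟨ splits-prod-forget p q (λ u v → pairWith pn (prod u R₁) (prod v R₂)) ⟩
        (splits p >>= λ ab → splits q >>= λ cd → prod (proj₁ ab) (forget (proj₁ cd)) >>= λ u →
           prod (proj₂ ab) (forget (proj₂ cd)) >>= λ v → pairWith pn (prod u R₁) (prod v R₂))
      ↭⟨ bind-congʳ (splits p) (λ ab → bind-congʳ (splits q) (λ cd →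
           ↭-sym (pairWith-bind pn (prod (proj₁ ab) (forget (proj₁ cd))) (prod (proj₂ ab) (forget (proj₂ cd))) (λ u → prod u R₁) (λ v → prod v R₂)))) ⟩
        (splits p >>= λ ab → splits q >>= λ cd →
           pairWith pn (prod (proj₁ ab) (forget (proj₁ cd)) >>= λ u → prod u R₁) (prod (proj₂ ab) (forget (proj₂ cd)) >>= λ v → prod v R₂))
      ∎
      where open PermutationReasoning

    prodProd-nodeʳ : ∀ R₁ R₂ p q → (prod q (nd R₁ R₂) >>= λ w → prod p (forget w)) ↭
      (splits p >>= λ ab → splits q >>= λ cd →
         pairWith pn (prod (proj₁ cd) R₁ >>= λ w → prod (proj₁ ab) (forget w)) (prod (proj₂ cd) R₂ >>= λ w → prod (proj₂ ab) (forget w)))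
    prodProd-nodeʳ R₁ R₂ p q = begin
        (prod q (nd R₁ R₂) >>= λ w → prod p (forget w))
      ≡⟨ trans (bind-assoc (splits q) _ _) (concatMap-cong (λ cd → trans (bind-assoc (prod (proj₁ cd) R₁) _ _)
           (concatMap-cong (λ x → concatMap-map _ (pn x) (prod (proj₂ cd) R₂)) (prod (proj₁ cd) R₁))) (splits q)) ⟩
        (splits q >>= λ cd → prod (proj₁ cd) R₁ >>= λ x → prod (proj₂ cd) R₂ >>= λ y → splits p >>= λ ab →
           pairWith pn (prod (proj₁ ab) (forget x)) (prod (proj₂ ab) (forget y)))
      ↭⟨ bind-congʳ (splits q) (λ cd → ↭-trans (bind-congʳ (prod (proj₁ cd) R₁) (λ x → bind-comm (prod (proj₂ cd) R₂) (splits p) _))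
                                                (bind-comm (prod (proj₁ cd) R₁) (splits p) _)) ⟩
        (splits q >>= λ cd → splits p >>= λ ab → prod (proj₁ cd) R₁ >>= λ x → prod (proj₂ cd) R₂ >>= λ y →
           pairWith pn (prod (proj₁ ab) (forget x)) (prod (proj₂ ab) (forget y)))
      ↭⟨ bind-congʳ (splits q) (λ cd → bind-congʳ (splits p) (λ ab →
           ↭-sym (pairWith-bind pn (prod (proj₁ cd) R₁) (prod (proj₂ cd) R₂) (λ x → prod (proj₁ ab) (forget x)) (λ y → prod (proj₂ ab) (forget y))))) ⟩
        (splits q >>= λ cd → splits p >>= λ ab →
           pairWith pn (prod (proj₁ cd) R₁ >>= λ w → prod (proj₁ ab) (forget w)) (prod (proj₂ cd) R₂ >>= λ w → prod (proj₂ ab) (forget w)))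
      ↭⟨ bind-comm (splits q) (splits p) _ ⟩
        (splits p >>= λ ab → splits q >>= λ cd →
           pairWith pn (prod (proj₁ cd) R₁ >>= λ w → prod (proj₁ ab) (forget w)) (prod (proj₂ cd) R₂ >>= λ w → prod (proj₂ ab) (forget w)))
      ∎
      where open PermutationReasoning

    prod-assoc : ∀ R p q → (prod p (forget q) >>= λ t → prod t R) ↭ (prod q R >>= λ w → prod p (forget w))
    prod-assoc lf p q = ↭-reflexive (trans (concatMap-pure (prod p (forget q))) (sym (++-identityʳ (prod p (forget q)))))
    prod-assoc (nd R₁ R₂) p q =
      ↭-trans (prodProd-nodeˡ R₁ R₂ p q)
        (↭-trans (bind-congʳ (splits p) (λ ab → bind-congʳ (splits q) (λ cd →
                    pairWith-cong pn (prod-assoc R₁ (proj₁ ab) (proj₁ cd)) (prod-assoc R₂ (proj₂ ab) (proj₂ cd)))))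
                 (↭-sym (prodProd-nodeʳ R₁ R₂ p q)))

  module ProductIdentities where

    open Splitting
    open Product
    open ListFacts
    open SplittingProducts using (splits-prod-forget)
    open Associativity using (prod-assoc)
    open import Data.List.Properties using (concatMap-pure; concatMap-cong)
    open import Data.List.Relation.Binary.Permutation.Propositional using (_↭_; ↭-sym; module PermutationReasoning)

    prodTrees-assoc : ∀ p q r → (prodTrees p q >>= λ t → prodTrees t r) ↭ (prodTrees q r >>= λ w → prodTrees p w)
    prodTrees-assoc p q r = begin
        (prodTrees p q >>= λ t → prodTrees t r)
      ↭⟨ bind-cong (prodTrees-prod p q) (λ t → prodTrees-prod t r) ⟩
        (prod p (forget q) >>= λ t → prod t (forget r))
      ↭⟨ prod-assoc (forget r) p q ⟩
        (prod q (forget r) >>= λ w → prod p (forget w))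
      ↭⟨ ↭-sym (bind-cong (prodTrees-prod q r) (λ w → prodTrees-prod p w)) ⟩
        (prodTrees q r >>= λ w → prodTrees p w)
      ∎
      where open PermutationReasoning

    splits-prodTrees : ∀ p q → (prodTrees p q >>= splits) ↭
      (splits p >>= λ ab → splits q >>= λ cd → pairWith _,_ (prodTrees (proj₁ ab) (proj₁ cd)) (prodTrees (proj₂ ab) (proj₂ cd)))
    splits-prodTrees p q = begin
        (prodTrees p q >>= splits)
      ↭⟨ bind-congˡ splits (prodTrees-prod p q) ⟩
        (prod p (forget q) >>= splits)
      ≡⟨ concatMap-cong (λ t → sym (concatMap-pure (splits t))) (prod p (forget q)) ⟩
        (prod p (forget q) >>= λ t → splits t >>= λ uv → [ (proj₁ uv , proj₂ uv) ])
      ↭⟨ splits-prod-forget p q (λ u v → [ (u , v) ]) ⟩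
        (splits p >>= λ ab → splits q >>= λ cd → prod (proj₁ ab) (forget (proj₁ cd)) >>= λ u → prod (proj₂ ab) (forget (proj₂ cd)) >>= λ v → [ (u , v) ])
      ≡⟨ concatMap-cong (λ ab → concatMap-cong (λ cd → concatMap-cong (λ u → sym (map-as-bind (prod (proj₂ ab) (forget (proj₂ cd))) (u ,_)))
           (prod (proj₁ ab) (forget (proj₁ cd)))) (splits q)) (splits p) ⟩
        (splits p >>= λ ab → splits q >>= λ cd → pairWith _,_ (prod (proj₁ ab) (forget (proj₁ cd))) (prod (proj₂ ab) (forget (proj₂ cd))))
      ↭⟨ bind-congʳ (splits p) (λ ab → bind-congʳ (splits q) (λ cd →
           ↭-sym (pairWith-cong _,_ (prodTrees-prod (proj₁ ab) (proj₁ cd)) (prodTrees-prod (proj₂ ab) (proj₂ cd))))) ⟩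
        (splits p >>= λ ab → splits q >>= λ cd → pairWith _,_ (prodTrees (proj₁ ab) (proj₁ cd)) (prodTrees (proj₂ ab) (proj₂ cd)))
      ∎
      where open PermutationReasoning

module Sums {c ℓ} (K : CommutativeRing c ℓ) where

  open CommutativeRing K renaming (Carrier to 𝕂)
  open import Algebra.Properties.CommutativeSemigroup +-commutativeSemigroup using (x∙yz≈y∙xz; interchange)
  open import Data.List using (List; []; _∷_; [_]; map; _++_; foldr)
  open import Data.List.Relation.Binary.Permutation.Propositional as Perm using (_↭_)
  open Combinatorics.ListFacts using (_>>=_)

  private variable
    a b : Level
    A : Set a
    B : Set b

  sumK : (B → 𝕂) → List B → 𝕂
  sumK g = foldr (λ x s → g x + s) 0#

  sumK-cong : {g h : B → 𝕂} (xs : List B) → (∀ x → g x ≈ h x) → sumK g xs ≈ sumK h xs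
  sumK-cong [] _ = refl
  sumK-cong (x ∷ xs) g≈h = +-cong (g≈h x) (sumK-cong xs g≈h)

  sumK-++ : (g : B → 𝕂) (xs ys : List B) → sumK g (xs ++ ys) ≈ sumK g xs + sumK g ys
  sumK-++ g [] ys = sym (+-identityˡ _)
  sumK-++ g (x ∷ xs) ys = trans (+-congˡ (sumK-++ g xs ys)) (sym (+-assoc _ _ _))

  sumK-↭ : (g : B → 𝕂) {xs ys : List B} → xs ↭ ys → sumK g xs ≈ sumK g ys
  sumK-↭ g Perm.refl = refl
  sumK-↭ g (Perm.prep x p) = +-congˡ (sumK-↭ g p)
  sumK-↭ g (Perm.swap x y p) = trans (+-congˡ (+-congˡ (sumK-↭ g p))) (x∙yz≈y∙xz _ _ _)
  sumK-↭ g (Perm.trans p q) = trans (sumK-↭ g p) (sumK-↭ g q)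

  sumK-bind : (g : B → 𝕂) (xs : List A) (f : A → List B) → sumK g (xs >>= f) ≈ sumK (λ x → sumK g (f x)) xs
  sumK-bind g [] f = refl
  sumK-bind g (x ∷ xs) f = trans (sumK-++ g (f x) (xs >>= f)) (+-congˡ (sumK-bind g xs f))

  sumK-map : (g : B → 𝕂) (f : A → B) (xs : List A) → sumK g (map f xs) ≈ sumK (λ x → g (f x)) xs
  sumK-map g f [] = refl
  sumK-map g f (x ∷ xs) = +-congˡ (sumK-map g f xs)

  sumK-single : (g : B → 𝕂) (x : B) → sumK g [ x ] ≈ g x
  sumK-single g x = +-identityʳ _

  sumK-0 : (xs : List B) → sumK (λ _ → 0#) xs ≈ 0#
  sumK-0 [] = refl
  sumK-0 (x ∷ xs) = trans (+-identityˡ _) (sumK-0 xs)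

  sumK-+ : (g h : B → 𝕂) (xs : List B) → sumK (λ x → g x + h x) xs ≈ sumK g xs + sumK h xs
  sumK-+ g h [] = sym (+-identityˡ 0#)
  sumK-+ g h (x ∷ xs) = trans (+-congˡ (sumK-+ g h xs)) (interchange _ _ _ _)

  sumK-*ˡ : (k : 𝕂) (g : B → 𝕂) (xs : List B) → sumK (λ x → k * g x) xs ≈ k * sumK g xs
  sumK-*ˡ k g [] = sym (zeroʳ k)
  sumK-*ˡ k g (x ∷ xs) = trans (+-congˡ (sumK-*ˡ k g xs)) (sym (distribˡ k _ _))

  sumK-*ʳ : (k : 𝕂) (g : B → 𝕂) (xs : List B) → sumK (λ x → g x * k) xs ≈ sumK g xs * k
  sumK-*ʳ k g [] = sym (zeroˡ k)
  sumK-*ʳ k g (x ∷ xs) = trans (+-congˡ (sumK-*ʳ k g xs)) (sym (distribʳ k _ _))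

  sumK-nested : {C : Set} (g : C → 𝕂) (xs : List A) (f : A → List B) (φ : A → B → C) →
    sumK (λ a → sumK (λ b → g (φ a b)) (f a)) xs ≈ sumK g (xs >>= λ a → f a >>= λ b → [ φ a b ])
  sumK-nested g xs f φ = sym (trans (sumK-bind g xs _)
    (sumK-cong xs (λ a → trans (sumK-bind g (f a) _) (sumK-cong (f a) (λ b → sumK-single g (φ a b))))))

  sumK-swap : (xs : List A) (ys : List B) (F : A → B → 𝕂) →
    sumK (λ x → sumK (F x) ys) xs ≈ sumK (λ y → sumK (λ x → F x y) xs) ys
  sumK-swap [] ys F = sym (sumK-0 ys)
  sumK-swap (x ∷ xs) ys F = trans (+-congˡ (sumK-swap xs ys F)) (sym (sumK-+ (F x) _ ys))

-- The coefficient of b in v is the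
-- functional of the indicator of b, so two combinations are equal as soon as every
-- functional extK g agrees on them.  Each Hopf axiom is proved in this form, which
-- turns it into an identity of sums over basis trees.
module Functionals {c ℓ} (K : CommutativeRing c ℓ) where

  open CommutativeRing K renaming (Carrier to 𝕂)
  open Over K
  open Sums K
  open import Data.Bool using (true; false; if_then_else_)
  open import Data.List using (List; []; _∷_; map)
  open import Data.Product using (proj₁; proj₂)
  open import Relation.Nullary using (does)
  open import Relation.Binary.Definitions using (DecidableEquality)
  open import Relation.Binary.Reasoning.Setoid setoid

  private variable
    A B C : Set

  extK-cong : {f f′ : B → 𝕂} (v : Comb B) → (∀ t → f t ≈ f′ t) → extK f v ≈ extK f′ v
  extK-cong v f≈f′ = sumK-cong v (λ ab → *-congˡ (f≈f′ (proj₂ ab)))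

  extK-scale : (g : B → 𝕂) (k : 𝕂) (v : Comb B) → extK g (scale k v) ≈ k * extK g v
  extK-scale g k v = begin
    extK g (scale k v)                                 ≈⟨ sumK-map (λ ab → proj₁ ab * g (proj₂ ab)) _ v ⟩
    sumK (λ ab → (k * proj₁ ab) * g (proj₂ ab)) v      ≈⟨ sumK-cong v (λ ab → *-assoc k _ _) ⟩
    sumK (λ ab → k * (proj₁ ab * g (proj₂ ab))) v      ≈⟨ sumK-*ˡ k _ v ⟩
    k * extK g v                                       ∎

  extK-ext : (g : C → 𝕂) (f : B → Comb C) (v : Comb B) → extK g (ext f v) ≈ extK (λ t → extK g (f t)) v
  extK-ext g f v = trans (sumK-bind (λ ab → proj₁ ab * g (proj₂ ab)) v (λ ab → scale (proj₁ ab) (f (proj₂ ab))))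
    (sumK-cong v (λ ab → extK-scale g (proj₁ ab) (f (proj₂ ab))))

  extK-units : (g : B → 𝕂) (h : A → B) (xs : List A) → extK g (map (λ t → (1# , h t)) xs) ≈ sumK (λ t → g (h t)) xs
  extK-units g h xs = trans (sumK-map (λ ab → proj₁ ab * g (proj₂ ab)) _ xs) (sumK-cong xs (λ t → *-identityˡ _))

  extK-*ˡ : (k : 𝕂) (f : B → 𝕂) (v : Comb B) → k * extK f v ≈ extK (λ t → k * f t) v
  extK-*ˡ k f v = trans (sym (sumK-*ˡ k _ v)) (sumK-cong v (λ ab → x∙yz≈y∙xz k _ _))
    where open import Algebra.Properties.CommutativeSemigroup *-commutativeSemigroup using (x∙yz≈y∙xz)

  extK-*ʳ : (k : 𝕂) (f : B → 𝕂) (v : Comb B) → extK f v * k ≈ extK (λ t → f t * k) v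
  extK-*ʳ k f v = trans (sym (sumK-*ʳ k _ v)) (sumK-cong v (λ ab → *-assoc _ _ k))

  sumK-extK : (xs : List A) (v : Comb B) (F : A → B → 𝕂) →
    sumK (λ x → extK (F x) v) xs ≈ extK (λ t → sumK (λ x → F x t) xs) v
  sumK-extK xs v F = trans (sumK-swap xs v (λ x ab → proj₁ ab * F x (proj₂ ab)))
    (sumK-cong v (λ ab → sumK-*ˡ (proj₁ ab) _ xs))

  coeffOf-extK : (_≟_ : DecidableEquality B) (b : B) (v : Comb B) →
    coeffOf _≟_ b v ≈ extK (λ t → if does (t ≟ b) then 1# else 0#) v
  coeffOf-extK _≟_ b [] = refl
  coeffOf-extK _≟_ b ((a , t) ∷ v) with does (t ≟ b)
  ... | true = +-cong (sym (*-identityʳ a)) (coeffOf-extK _≟_ b v)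
  ... | false = +-cong (sym (zeroʳ a)) (coeffOf-extK _≟_ b v)

  EqComb-by-functionals : (_≟_ : DecidableEquality B) (v w : Comb B) → (∀ g → extK g v ≈ extK g w) → EqComb _≟_ v w
  EqComb-by-functionals _≟_ v w same b =
    trans (coeffOf-extK _≟_ b v) (trans (same _) (sym (coeffOf-extK _≟_ b w)))

module PSymHopf {c ℓ} (K : CommutativeRing c ℓ) where

  open CommutativeRing K renaming (Carrier to 𝕂)
  open Over K
  open Sums K
  open Functionals K
  open Combinatorics.ListFacts using (_>>=_; pairWith; bind-upTo-cong)
  open Combinatorics.Splitting using (splits; splitsT; unpainted; psplits-splits; psplit-size; psplit-last)
  open Combinatorics.Coassociativity using (splits-coassociative)
  open Combinatorics.Product using (prod; prodTrees-prod)
  open Combinatorics.ProductIdentities using (prodTrees-assoc; splits-prodTrees)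
  open import Data.Bool using (if_then_else_)
  open import Data.Nat using (ℕ; zero; suc; _≤_; _<_; s≤s; _≡ᵇ_)
  open import Data.Nat.Properties using (<⇒≤; <-≤-trans; ≤-refl)
  open import Data.List using (List; [_]; map; _++_; upTo)
  open import Data.List.Properties using (map-∘; upTo-∷ʳ)
  open import Data.Product using (_×_; proj₁; proj₂)
  open import Data.Sum using (inj₁; inj₂)
  import Relation.Binary.PropositionalEquality as P
  open import Relation.Binary.Reasoning.Setoid setoid

  extK-mul : (g : PTree → 𝕂) (x y : PSym) → extK g (x · y) ≈ extK (λ p → extK (λ q → sumK g (prodTrees p q)) y) x
  extK-mul g x y = trans (extK-ext g _ x) (extK-cong x (λ p → trans (extK-ext g _ y) (extK-cong y (λ q → extK-units g (λ t → t) (prodTrees p q)))))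

  ΔB-splits : ∀ p → ΔB p P.≡ map (1# ,_) (splits p)
  ΔB-splits p = P.trans (map-∘ (upTo _)) (P.cong (map (1# ,_)) (psplits-splits p))

  extK-mapΔB : {C : Set} (g : C → 𝕂) (φ : PTree × PTree → C) (p : PTree) →
    extK g (map (λ kab → (proj₁ kab , φ (proj₂ kab))) (ΔB p)) ≈ sumK (λ ab → g (φ ab)) (splits p)
  extK-mapΔB g φ p = trans (reflexive (P.cong (extK g) (P.trans (P.cong (map _) (ΔB-splits p)) (P.sym (map-∘ (splits p))))))
                           (extK-units g φ (splits p))

  extK-Δ : (g : PTree × PTree → 𝕂) (x : PSym) → extK g (Δ x) ≈ extK (λ p → sumK g (splits p)) x
  extK-Δ g x = trans (extK-ext g ΔB x)
    (extK-cong x (λ p → trans (reflexive (P.cong (extK g) (ΔB-splits p))) (extK-units g (λ ab → ab) (splits p))))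

  extK-tensor : {A B : Set} (g : A × B → 𝕂) (as : List A) (bs : List B) →
    extK g (tensor (map (1# ,_) as) (map (1# ,_) bs)) ≈ sumK g (pairWith _,_ as bs)
  extK-tensor g as bs = begin
      extK g (tensor (map (1# ,_) as) (map (1# ,_) bs))
    ≈⟨ reflexive (P.cong (extK g) (concatMap-map _ (1# ,_) as)) ⟩
      sumK (λ ab → proj₁ ab * g (proj₂ ab)) (as >>= λ a → map (λ cd → (1# * proj₁ cd , (a , proj₂ cd))) (map (1# ,_) bs))
    ≈⟨ sumK-bind _ as _ ⟩
      sumK (λ a → sumK (λ ab → proj₁ ab * g (proj₂ ab)) (map (λ cd → (1# * proj₁ cd , (a , proj₂ cd))) (map (1# ,_) bs))) as
    ≈⟨ sumK-cong as (λ a → trans (reflexive (P.cong (sumK _) (P.sym (map-∘ bs))))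
         (trans (sumK-map _ _ bs) (sumK-cong bs (λ b → trans (*-congʳ (*-identityˡ 1#)) (*-identityˡ _))))) ⟩
      sumK (λ a → sumK (λ b → g (a , b)) bs) as
    ≈⟨ sym (trans (sumK-bind g as _) (sumK-cong as (λ a → sumK-map g (a ,_) bs))) ⟩
      sumK g (pairWith _,_ as bs)
    ∎
    where open import Data.List.Properties using (concatMap-map)

  u : PSym
  u = basis (un lf)

  extK-basis : {B : Set} (g : B → 𝕂) (t : B) → extK g (basis t) ≈ g t
  extK-basis g t = trans (+-identityʳ _) (*-identityˡ _)

  ·-assoc : ∀ x y z → ((x · y) · z) ≈V (x · (y · z))
  ·-assoc x y z = EqComb-by-functionals _≟P_ ((x · y) · z) (x · (y · z)) λ g → begin
      extK g ((x · y) · z)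
    ≈⟨ trans (extK-mul g (x · y) z) (extK-mul _ x y) ⟩
      extK (λ p → extK (λ q → sumK (λ t → extK (λ r → sumK g (prodTrees t r)) z) (prodTrees p q)) y) x
    ≈⟨ extK-cong x (λ p → extK-cong y (λ q → trans (sumK-extK (prodTrees p q) z (λ t r → sumK g (prodTrees t r)))
          (extK-cong z (λ r → assoc-basis g p q r)))) ⟩
      extK (λ p → extK (λ q → extK (λ r → sumK (λ w → sumK g (prodTrees p w)) (prodTrees q r)) z) y) x
    ≈⟨ sym (trans (extK-mul g x (y · z)) (extK-cong x (λ p → extK-mul (λ w → sumK g (prodTrees p w)) y z))) ⟩
      extK g (x · (y · z))
    ∎
    where
      assoc-basis : ∀ (g : PTree → 𝕂) p q r →
        sumK (λ t → sumK g (prodTrees t r)) (prodTrees p q) ≈ sumK (λ w → sumK g (prodTrees p w)) (prodTrees q r)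
      assoc-basis g p q r = trans (sym (sumK-bind g (prodTrees p q) (λ t → prodTrees t r)))
        (trans (sumK-↭ g (prodTrees-assoc p q r)) (sumK-bind g (prodTrees q r) (λ w → prodTrees p w)))

  -- F_(un lf) is a right unit: grafting p onto the one-leaf tree gives p
  extK-·u : ∀ (g : PTree → 𝕂) x → extK g (x · u) ≈ extK g x
  extK-·u g x = trans (extK-mul g x u) (extK-cong x (λ p → trans (+-identityʳ _) (trans (*-identityˡ _) (+-identityʳ _))))

  rightUnit : RightUnit u
  rightUnit x = EqComb-by-functionals _≟P_ (x · u) x (λ g → extK-·u g x)

  extK-Δ⊗id∘Δ : (g : PTree × PTree × PTree → 𝕂) (x : PSym) →
    extK g (Δ⊗id∘Δ x) ≈ extK (λ p → sumK (λ ab → sumK (λ cd → g (proj₁ cd , proj₂ cd , proj₂ ab)) (splits (proj₁ ab))) (splits p)) x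
  extK-Δ⊗id∘Δ g x =
    trans (extK-ext g (λ pq → map (λ kab → (proj₁ kab , (proj₁ (proj₂ kab) , proj₂ (proj₂ kab) , proj₂ pq))) (ΔB (proj₁ pq))) (Δ x))
    (trans (extK-Δ _ x)
    (extK-cong x (λ p → sumK-cong (splits p) (λ ab → extK-mapΔB g (λ cd → (proj₁ cd , proj₂ cd , proj₂ ab)) (proj₁ ab)))))

  extK-id⊗Δ∘Δ : (g : PTree × PTree × PTree → 𝕂) (x : PSym) →
    extK g (id⊗Δ∘Δ x) ≈ extK (λ p → sumK (λ ab → sumK (λ cd → g (proj₁ ab , proj₁ cd , proj₂ cd)) (splits (proj₂ ab))) (splits p)) x
  extK-id⊗Δ∘Δ g x =
    trans (extK-ext g (λ pq → map (λ kab → (proj₁ kab , (proj₁ pq , proj₁ (proj₂ kab) , proj₂ (proj₂ kab)))) (ΔB (proj₂ pq))) (Δ x))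
    (trans (extK-Δ _ x)
    (extK-cong x (λ p → sumK-cong (splits p) (λ ab → extK-mapΔB g (λ cd → (proj₁ ab , proj₁ cd , proj₂ cd)) (proj₂ ab)))))

  Δ-coassoc : ∀ x → Δ⊗id∘Δ x ≈V3 id⊗Δ∘Δ x
  Δ-coassoc x = EqComb-by-functionals _≟P3_ (Δ⊗id∘Δ x) (id⊗Δ∘Δ x) λ g →
    trans (extK-Δ⊗id∘Δ g x) (trans (extK-cong x (λ p →
      trans (sumK-nested g (splits p) (λ ab → splits (proj₁ ab)) (λ ab cd → (proj₁ cd , proj₂ cd , proj₂ ab)))
        (trans (sumK-↭ g (splits-coassociative p (λ a b c → [ (a , b , c) ])))
          (sym (sumK-nested g (splits p) (λ ab → splits (proj₂ ab)) (λ ab cd → (proj₁ ab , proj₁ cd , proj₂ cd)))))))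
    (sym (extK-id⊗Δ∘Δ g x)))

  -- counit: among the splittings of p only the one at the first (last) leaf has a
  -- left (right) piece without nodes, and it leaves p on the other side
  εT : Tree → 𝕂
  εT a = if size a ≡ᵇ 0 then 1# else 0#

  zero-weights : {B : Set} (h : B → 𝕂) (xs : List B) → sumK (λ x → 0# * h x) xs ≈ 0#
  zero-weights h xs = trans (sumK-cong xs (λ x → zeroˡ (h x))) (sumK-0 xs)

  counitˡ-splitsT : ∀ t (h : Tree → 𝕂) → sumK (λ ab → εT (proj₁ ab) * h (proj₂ ab)) (splitsT t) ≈ h t
  counitˡ-splitsT lf h = trans (+-identityʳ _) (*-identityˡ _)
  counitˡ-splitsT (nd l r) h = trans (sumK-++ _ (map _ (splitsT l)) (map _ (splitsT r)))
    (trans (+-cong (trans (sumK-map _ _ (splitsT l)) (counitˡ-splitsT l (λ b → h (nd b r))))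
                   (trans (sumK-map _ _ (splitsT r)) (zero-weights (λ ab → h (proj₂ ab)) (splitsT r)))) (+-identityʳ _))

  counitʳ-splitsT : ∀ t (h : Tree → 𝕂) → sumK (λ ab → εT (proj₂ ab) * h (proj₁ ab)) (splitsT t) ≈ h t
  counitʳ-splitsT lf h = trans (+-identityʳ _) (*-identityˡ _)
  counitʳ-splitsT (nd l r) h = trans (sumK-++ _ (map _ (splitsT l)) (map _ (splitsT r)))
    (trans (+-cong (trans (sumK-map _ _ (splitsT l)) (zero-weights (λ ab → h (proj₁ ab)) (splitsT l)))
                   (trans (sumK-map _ _ (splitsT r)) (counitʳ-splitsT r (λ a → h (nd l a))))) (+-identityˡ _))

  counitˡ-splits : ∀ p (h : PTree → 𝕂) → sumK (λ ab → εB (proj₁ ab) * h (proj₂ ab)) (splits p) ≈ h p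
  counitˡ-splits (un t) h = trans (sumK-map _ unpainted (splitsT t)) (counitˡ-splitsT t (λ b → h (un b)))
  counitˡ-splits (pn l r) h = trans (sumK-++ _ (map _ (splits l)) (map _ (splits r)))
    (trans (+-cong (trans (sumK-map _ _ (splits l)) (counitˡ-splits l (λ b → h (pn b r))))
                   (trans (sumK-map _ _ (splits r)) (zero-weights (λ ab → h (proj₂ ab)) (splits r)))) (+-identityʳ _))

  counitʳ-splits : ∀ p (h : PTree → 𝕂) → sumK (λ ab → εB (proj₂ ab) * h (proj₁ ab)) (splits p) ≈ h p
  counitʳ-splits (un t) h = trans (sumK-map _ unpainted (splitsT t)) (counitʳ-splitsT t (λ b → h (un b)))
  counitʳ-splits (pn l r) h = trans (sumK-++ _ (map _ (splits l)) (map _ (splits r)))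
    (trans (+-cong (trans (sumK-map _ _ (splits l)) (zero-weights (λ ab → h (proj₁ ab)) (splits l)))
                   (trans (sumK-map _ _ (splits r)) (counitʳ-splits r (λ a → h (pn l a))))) (+-identityˡ _))

  extK-scale-basis : {B : Set} (g : B → 𝕂) (k : 𝕂) (t : B) → extK g (scale k (basis t)) ≈ k * g t
  extK-scale-basis g k t = trans (extK-scale g k (basis t)) (*-congˡ (extK-basis g t))

  counitˡ : ∀ x → ε⊗id∘Δ x ≈V x
  counitˡ x = EqComb-by-functionals _≟P_ (ε⊗id∘Δ x) x λ g →
    trans (extK-ext g (λ pq → scale (εB (proj₁ pq)) (basis (proj₂ pq))) (Δ x)) (trans (extK-Δ _ x) (extK-cong x (λ p →
      trans (sumK-cong (splits p) (λ pq → extK-scale-basis g (εB (proj₁ pq)) (proj₂ pq))) (counitˡ-splits p g))))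

  counitʳ : ∀ x → id⊗ε∘Δ x ≈V x
  counitʳ x = EqComb-by-functionals _≟P_ (id⊗ε∘Δ x) x λ g →
    trans (extK-ext g (λ pq → scale (εB (proj₂ pq)) (basis (proj₁ pq))) (Δ x)) (trans (extK-Δ _ x) (extK-cong x (λ p →
      trans (sumK-cong (splits p) (λ pq → extK-scale-basis g (εB (proj₂ pq)) (proj₁ pq))) (counitʳ-splits p g))))

  -- ε is multiplicative: unless q = un lf, the product F_p · F_q only contains trees
  -- with a painted root, on which ε vanishes
  ε-prodTrees : ∀ p q → sumK εB (prodTrees p q) ≈ εB p * εB q
  ε-prodTrees p q = trans (sumK-↭ εB (prodTrees-prod p q)) (ε-prod q)
    where
      ε-prod-node : ∀ Q₁ Q₂ → sumK εB (prod p (nd Q₁ Q₂)) ≈ 0#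
      ε-prod-node Q₁ Q₂ = trans (sumK-bind εB (splits p) _) (trans (sumK-cong (splits p) (λ ab →
        trans (sumK-bind εB (prod (proj₁ ab) Q₁) _) (trans (sumK-cong (prod (proj₁ ab) Q₁) (λ x →
          trans (sumK-map εB (pn x) (prod (proj₂ ab) Q₂)) (sumK-0 (prod (proj₂ ab) Q₂)))) (sumK-0 (prod (proj₁ ab) Q₁)))))
        (sumK-0 (splits p)))
      ε-prod : ∀ q → sumK εB (prod p (forget q)) ≈ εB p * εB q
      ε-prod (un lf) = trans (+-identityʳ _) (sym (*-identityʳ _))
      ε-prod (un (nd a b)) = trans (ε-prod-node a b) (sym (zeroʳ _))
      ε-prod (pn a b) = trans (ε-prod-node (forget a) (forget b)) (sym (zeroʳ _))

  ε-mult : ∀ x y → ε (x · y) ≈ ε x * ε y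
  ε-mult x y = begin
      extK εB (x · y)
    ≈⟨ extK-mul εB x y ⟩
      extK (λ p → extK (λ q → sumK εB (prodTrees p q)) y) x
    ≈⟨ extK-cong x (λ p → extK-cong y (λ q → ε-prodTrees p q)) ⟩
      extK (λ p → extK (λ q → εB p * εB q) y) x
    ≈⟨ sym (extK-cong x (λ p → extK-*ˡ (εB p) εB y)) ⟩
      extK (λ p → εB p * extK εB y) x
    ≈⟨ sym (extK-*ʳ (extK εB y) εB x) ⟩
      ε x * ε y
    ∎

  productPairs : PTree × PTree → PTree × PTree → List (PTree × PTree)
  productPairs pp qq = pairWith _,_ (prodTrees (proj₁ pp) (proj₁ qq)) (prodTrees (proj₂ pp) (proj₂ qq))

  extK-·₂ : (g : PTree × PTree → 𝕂) (X Y : PSym2) → extK g (X ·₂ Y) ≈ extK (λ pp → extK (λ qq → sumK g (productPairs pp qq)) Y) X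
  extK-·₂ g X Y = trans (extK-ext g _ X) (extK-cong X (λ pp → trans (extK-ext g _ Y) (extK-cong Y (λ qq →
    extK-tensor g (prodTrees (proj₁ pp) (proj₁ qq)) (prodTrees (proj₂ pp) (proj₂ qq))))))

  Δ-mult : ∀ x y → Δ (x · y) ≈V2 (Δ x ·₂ Δ y)
  Δ-mult x y = EqComb-by-functionals _≟P2_ (Δ (x · y)) (Δ x ·₂ Δ y) λ g → begin
      extK g (Δ (x · y))
    ≈⟨ trans (extK-Δ g (x · y)) (extK-mul _ x y) ⟩
      extK (λ p → extK (λ q → sumK (λ t → sumK g (splits t)) (prodTrees p q)) y) x
    ≈⟨ extK-cong x (λ p → extK-cong y (λ q → Δ-prodTrees g p q)) ⟩
      extK (λ p → extK (λ q → sumK (λ pp → sumK (λ qq → sumK g (productPairs pp qq)) (splits q)) (splits p)) y) x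
    ≈⟨ extK-cong x (λ p → trans (sym (sumK-extK (splits p) y _)) (sumK-cong (splits p) (λ pp → sym (extK-Δ _ y)))) ⟩
      extK (λ p → sumK (λ pp → extK (λ qq → sumK g (productPairs pp qq)) (Δ y)) (splits p)) x
    ≈⟨ sym (trans (extK-·₂ g (Δ x) (Δ y)) (extK-Δ _ x)) ⟩
      extK g (Δ x ·₂ Δ y)
    ∎
    where
      Δ-prodTrees : (g : PTree × PTree → 𝕂) (p q : PTree) → sumK (λ t → sumK g (splits t)) (prodTrees p q) ≈
        sumK (λ pp → sumK (λ qq → sumK g (productPairs pp qq)) (splits q)) (splits p)
      Δ-prodTrees g p q = trans (sym (sumK-bind g (prodTrees p q) splits)) (trans (sumK-↭ g (splits-prodTrees p q))
        (trans (sumK-bind g (splits p) _) (sumK-cong (splits p) (λ pp → sumK-bind g (splits q) _))))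

  -- Splitting p at its last leaf gives (p , un lf), and
  -- S(p) · F_(un lf) = S(p); so the antipode equation for p ≠ un lf forces
  -- S(p) = - Σ_{i<|p|} S(p₀⁽ⁱ⁾) · F_(p₁⁽ⁱ⁾), where (p₀⁽ⁱ⁾ , p₁⁽ⁱ⁾) = psplit i p and
  -- p₀⁽ⁱ⁾ has i < |p| nodes.  The recursion is computed with fuel bounding |p|.
  antipodeWith : ℕ → PTree → PSym
  antipodeWith zero p = u
  antipodeWith (suc k) p =
    if psize p ≡ᵇ 0 then u
    else scale (- 1#) (upTo (psize p) >>= λ i → antipodeWith k (proj₁ (psplit i p)) · basis (proj₂ (psplit i p)))

  antipode : PTree → PSym
  antipode p = antipodeWith (suc (psize p)) p

  antipodeWith-fuel : ∀ k k′ p → psize p < k → psize p < k′ → antipodeWith k p P.≡ antipodeWith k′ p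
  antipodeWith-fuel (suc k) (suc k′) p (s≤s p≤k) (s≤s p≤k′) =
    P.cong (λ v → if psize p ≡ᵇ 0 then u else scale (- 1#) v)
      (bind-upTo-cong (psize p) (λ i i<p → P.cong (_· basis (proj₂ (psplit i p)))
        (antipodeWith-fuel k k′ (proj₁ (psplit i p)) (prefix< i<p p≤k) (prefix< i<p p≤k′))))
    where
      prefix< : ∀ {i m} → i < psize p → psize p ≤ m → psize (proj₁ (psplit i p)) < m
      prefix< {i} i<p p≤m = P.subst (_< _) (P.sym (psplit-size i p (<⇒≤ i<p))) (<-≤-trans i<p p≤m)

  antipode-unfold : ∀ p n → psize p P.≡ suc n →
    antipode p P.≡ scale (- 1#) (upTo (suc n) >>= λ i → antipode (proj₁ (psplit i p)) · basis (proj₂ (psplit i p)))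
  antipode-unfold p n |p|≡1+n =
    P.trans (P.cong (λ k → antipodeWith (suc k) p) |p|≡1+n) (P.trans (unfold (suc n) |p|≡1+n)
      (P.cong (scale (- 1#)) (bind-upTo-cong (suc n) (λ i i<1+n → P.cong (_· basis (proj₂ (psplit i p)))
        (antipodeWith-fuel (suc n) (suc (psize (proj₁ (psplit i p)))) (proj₁ (psplit i p)) (prefix< i<1+n) ≤-refl)))))
    where
      unfold : ∀ k → psize p P.≡ suc n → antipodeWith (suc k) p P.≡
        scale (- 1#) (upTo (suc n) >>= λ i → antipodeWith k (proj₁ (psplit i p)) · basis (proj₂ (psplit i p)))
      unfold k eq rewrite eq = P.refl
      prefix< : ∀ {i} → i < suc n → psize (proj₁ (psplit i p)) < suc n
      prefix< {i} i<1+n = P.subst (_< suc n) (P.sym (psplit-size i p (P.subst (i ≤_) (P.sym |p|≡1+n) (<⇒≤ i<1+n)))) i<1+n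

  antipodeTerm : (PTree → 𝕂) → PTree → ℕ → 𝕂
  antipodeTerm g p i = extK g (antipode (proj₁ (psplit i p)) · basis (proj₂ (psplit i p)))

  extK-antipode : ∀ g p n → psize p P.≡ suc n → extK g (antipode p) ≈ - sumK (antipodeTerm g p) (upTo (suc n))
  extK-antipode g p n |p|≡1+n = begin
      extK g (antipode p)
    ≡⟨ P.cong (extK g) (antipode-unfold p n |p|≡1+n) ⟩
      extK g (scale (- 1#) (upTo (suc n) >>= term))
    ≈⟨ extK-scale g (- 1#) (upTo (suc n) >>= term) ⟩
      - 1# * extK g (upTo (suc n) >>= term)
    ≈⟨ -1*x≈-x _ ⟩
      - extK g (upTo (suc n) >>= term)
    ≈⟨ -‿cong (sumK-bind (λ ab → proj₁ ab * g (proj₂ ab)) (upTo (suc n)) term) ⟩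
      - sumK (antipodeTerm g p) (upTo (suc n))
    ∎
    where
      open import Algebra.Properties.Ring ring using (-1*x≈-x)
      term : ℕ → PSym
      term i = antipode (proj₁ (psplit i p)) · basis (proj₂ (psplit i p))

  -- the antipode equation on a basis element: the term at the last leaf is S(p),
  -- which cancels the others
  antipode-basis-nonempty : ∀ g p n → psize p P.≡ suc n → sumK (antipodeTerm g p) (upTo (suc (psize p))) ≈ εB p * g (un lf)
  antipode-basis-nonempty g p n |p|≡1+n = begin
      sumK T (upTo (suc (psize p)))
    ≡⟨ P.cong (λ k → sumK T (upTo (suc k))) |p|≡1+n ⟩
      sumK T (upTo (suc (suc n)))
    ≡⟨ P.cong (sumK T) (P.sym (upTo-∷ʳ (suc n))) ⟩
      sumK T (upTo (suc n) ++ [ suc n ])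
    ≈⟨ trans (sumK-++ T (upTo (suc n)) [ suc n ]) (+-congˡ (sumK-single T (suc n))) ⟩
      sumK T (upTo (suc n)) + T (suc n)
    ≈⟨ +-congˡ last-term ⟩
      sumK T (upTo (suc n)) + - sumK T (upTo (suc n))
    ≈⟨ -‿inverseʳ _ ⟩
      0#
    ≈⟨ sym (zeroˡ _) ⟩
      0# * g (un lf)
    ≡⟨ P.cong (λ k → (if k ≡ᵇ 0 then 1# else 0#) * g (un lf)) (P.sym |p|≡1+n) ⟩
      εB p * g (un lf)
    ∎
    where
      T = antipodeTerm g p
      last-term : T (suc n) ≈ - sumK T (upTo (suc n))
      last-term = begin
          T (suc n)
        ≡⟨ P.cong (λ ab → extK g (antipode (proj₁ ab) · basis (proj₂ ab)))
                  (P.subst (λ k → psplit k p P.≡ (p , un lf)) |p|≡1+n (psplit-last p)) ⟩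
          extK g (antipode p · u)
        ≈⟨ extK-·u g (antipode p) ⟩
          extK g (antipode p)
        ≈⟨ extK-antipode g p n |p|≡1+n ⟩
          - sumK T (upTo (suc n))
        ∎

  antipode-basis : ∀ g p → sumK (antipodeTerm g p) (upTo (suc (psize p))) ≈ εB p * g (un lf)
  antipode-basis g (un lf) = trans (+-identityʳ _) (trans (extK-·u g u) (trans (extK-basis g (un lf)) (sym (*-identityˡ _))))
  antipode-basis g (un (nd a b)) = antipode-basis-nonempty g (un (nd a b)) _ P.refl
  antipode-basis g (pn a b) = antipode-basis-nonempty g (pn a b) _ P.refl

  leftAntipode : LeftAntipode u antipode
  leftAntipode x = EqComb-by-functionals _≟P_ (ext (λ pq → antipode (proj₁ pq) · basis (proj₂ pq)) (Δ x)) (scale (ε x) u) λ g → begin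
      extK g (ext (λ pq → antipode (proj₁ pq) · basis (proj₂ pq)) (Δ x))
    ≈⟨ trans (extK-ext g _ (Δ x)) (extK-ext _ ΔB x) ⟩
      extK (λ p → extK (λ pq → extK g (antipode (proj₁ pq) · basis (proj₂ pq))) (ΔB p)) x
    ≈⟨ extK-cong x (λ p → trans (extK-units _ (λ i → psplit i p) (upTo (suc (psize p)))) (antipode-basis g p)) ⟩
      extK (λ p → εB p * g (un lf)) x
    ≈⟨ sym (extK-*ʳ (g (un lf)) εB x) ⟩
      ε x * g (un lf)
    ≈⟨ sym (extK-scale-basis g (ε x) (un lf)) ⟩
      extK g (scale (ε x) u)
    ∎

  isOneSidedHopf : IsOneSidedHopf u antipode
  isOneSidedHopf = record
    { assoc = ·-assoc
    ; oneSidedUnit = inj₂ rightUnit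
    ; coassoc = Δ-coassoc
    ; counitˡ = counitˡ
    ; counitʳ = counitʳ
    ; Δ-mult = Δ-mult
    ; Δ-unit = λ _ → refl
    ; ε-mult = ε-mult
    ; ε-unit = extK-basis εB (un lf)
    ; oneSidedAntipode = inj₁ leftAntipode
    }

mainTheorem11 : {c ℓ : Level} (K : CommutativeRing c ℓ) → Over.IsFieldChar0 K →
    ∃₂ λ (u : Over.PSym K) (s : PTree → Over.PSym K) → Over.IsOneSidedHopf K u s
mainTheorem11 K _ = PSymHopf.u K , PSymHopf.antipode K , PSymHopf.isOneSidedHopf K
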